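{- Let $\theta_q:H_n(q)\to\mathbb Z[q^{1/2},q^{ -1/2}]$ be any $\mathbb Z[q^{1/2},q^{ -1/2}]$-linear function, let $s_{i_1}\cdots s_{i_m}$ be any expression in the generators of $\mathfrak S_n$, and let $B$ be the weighted path matrix of its wiring diagram. Then $$\theta_q\big((1+T_{s_{i_1}})\cdots(1+T_{s_{i_m}})\big)=\sigma_B\big(\mathrm{Imm}_{\theta_q}(x)\big),\qquad\text{where }\ \mathrm{Imm}_{\theta_q}(x)=\sum_{w\in\mathfrak S_n}\theta_q(T_w)\,q^{ -\ell(w)/2}\,x_{1,w_1}x_{2,w_2}\cdots x_{n,w_n}.$$
   Context: The Hecke algebra $H_n(q)$ is the unital algebra over $\mathbb Z[q^{1/2},q^{ -1/2}]$ generated by $T_{s_1},\dots,T_{s_{n-1}}$ with $T_{s_i}^2=(q-1)T_{s_i}+qT_e$, $T_{s_i}T_{s_j}T_{s_i}=T_{s_j}T_{s_i}T_{s_j}$ for $|i-j|=1$, $T_{s_i}T_{s_j}=T_{s_j}T_{s_i}$ for $|i-j|\ge2$; $T_w=T_{s_{i_1}}\cdots T_{s_{i_\ell}}$ for a reduced expression of $w$; $1=T_e$; $\ell(w)$ the length. One-line notation $w_1\cdots w_n$ of $w$ is obtained by letting an expression of $w$ act on the word $1\cdots n$, $s_j$ swapping letters in positions $j,j+1$. Quantum matrix bialgebra $\mathcal A$: generated over $\mathbb Z[q^{1/2},q^{ -1/2}]$ by $x_{i,j}$ with relations, for $i<j$, $k<\ell$: $x_{i,\ell}x_{i,k}=q^{1/2}x_{i,k}x_{i,\ell}$,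 $x_{j,k}x_{i,\ell}=x_{i,\ell}x_{j,k}$, $x_{j,k}x_{i,k}=q^{1/2}x_{i,k}x_{j,k}$, $x_{j,\ell}x_{i,k}=x_{i,k}x_{j,\ell}+(q^{1/2}-q^{ -1/2})x_{i,\ell}x_{j,k}$; $x^{u,v}=x_{u_1,v_1}\cdots x_{u_n,v_n}$; $\mathcal A_{[n],[n]}$ is the span of the $x^{u,v}$, with basis $\{x^{e,v}\}$. Wiring diagram $G$ of $s_{i_1}\cdots s_{i_m}$: left-to-right concatenation of elementary diagrams $G_1..G_m$ with levels $1..n$ (bottom to top); in $G_j$ levels $h\notin\{i_j,i_j+1\}$ are horizontal edges of weight 1 and levels $i_j,i_j+1$ pass through a central vertex via edges weighted $z_{i_j,j,1}$ (in from level $i_j$), $z_{i_j,j,2}$ (out to level $i_j$), $z_{i_j+1,j,1}$ (in from level $i_j+1$), $z_{i_j+1,j,2}$ (out to level $i_j+1$); sources $1..n$ left, sinks $1..n$ right, edges oriented left to right. $Z_G$: algebra over $\mathbb Z[q^{\pm1/2}]$ (central) generated by the variables, $z_{h,j,k},z_{h',j',k'}$ commuting if $j\ne j'$ or $k\ne k'$, and $z_{i_j+1,j,k}z_{i_j,j,k}=q^{1/2}z_{i_j,j,k}z_{i_j+1,j,k}$; $z_G$ the product of all $4m$ variables in lexicographic order; $[z_G]f$ the coefficient of $z_G$ in the lexicographically ordered monomial basis. Path weight = product of edge weights in traversal order; $B=(b_{i,j})$ with $b_{i,j}$ the sum of weights of paths source $i\to$ sink $j$; $\sigma_B$ the linear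 map $\mathcal A_{[n],[n]}\to\mathbb Z[q^{\pm1/2}]$ with $\sigma_B(x^{e,v})=[z_G]b_{1,v_1}\cdots b_{n,v_n}$. -}

module Defs where

open import Data.Nat as ℕ using (ℕ; zero; suc; _∸_)
open import Data.Integer as ℤ using (ℤ; +_; -[1+_])
open import Data.List using (List; []; _∷_; _++_; map; concatMap; foldl; filter; length; upTo)
open import Data.Product using (_×_; _,_)
open import Data.Bool using (Bool; true; false; if_then_else_; _∧_; _∨_)
open import Data.Fin using (Fin; toℕ)
open import Relation.Nullary using (does)
open import Relation.Binary.PropositionalEquality using (_≡_)
import Data.List.Properties as LP
import Data.Product.Properties as PP

-- The coefficient ring ℤ[q^{1/2}, q^{-1/2}] = ℤ[t, t^{-1}], t = q^{1/2}.
-- An element is a formal (unnormalised) sum  Σ c · t^e  given as a list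
-- of pairs (e , c); two elements are equal when all coefficients agree.

Laurent : Set
Laurent = List (ℤ × ℤ)

coeff : Laurent → ℤ → ℤ
coeff [] e = + 0
coeff ((e' , c) ∷ r) e = (if does (e' ℤ.≟ e) then c else + 0) ℤ.+ coeff r e

infix 4 _≈_
_≈_ : Laurent → Laurent → Set
a ≈ b = ∀ e → coeff a e ≡ coeff b e

0L : Laurent
0L = []

1L : Laurent
1L = (+ 0 , + 1) ∷ []

tpow : ℤ → Laurent
tpow e = (e , + 1) ∷ []

infixl 6 _+L_
_+L_ : Laurent → Laurent → Laurent
a +L b = a ++ b

infixl 7 _*L_
_*L_ : Laurent → Laurent → Laurent
a *L b = concatMap (λ { (e , c) → map (λ { (e' , c') → (e ℤ.+ e' , c ℤ.* c') }) b }) a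

sumL : List Laurent → Laurent
sumL [] = 0L
sumL (x ∷ xs) = x +L sumL xs

qL : Laurent
qL = tpow (+ 2)

qMinus1 : Laurent
qMinus1 = qL +L ((+ 0 , -[1+ 0 ]) ∷ [])

-- Permutations of [n] in one-line notation  w₁ ⋯ wₙ  (letters 1..n).

Word : Set
Word = List ℕ

idWord : ℕ → Word
idWord n = map suc (upTo n)

insertions : ℕ → Word → List Word
insertions x [] = (x ∷ []) ∷ []
insertions x (y ∷ ys) = (x ∷ y ∷ ys) ∷ map (y ∷_) (insertions x ys)

-- the symmetric group 𝔖ₙ, each permutation listed exactly once
perms : ℕ → List Word
perms zero = [] ∷ []
perms (suc n) = concatMap (insertions (suc n)) (perms n)

-- Coxeter length ℓ(w) = number of inversions of the one-line notation
len : Word → ℕ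
len [] = 0
len (x ∷ xs) = length (filter (ℕ._<? x) xs) ℕ.+ len xs

-- Convention: the one-line notation of s_{i₁} ⋯ s_{i_ℓ} is obtained by
-- applying s_{i_ℓ} first, …, s_{i₁} last to the word 1 ⋯ n, each s_j
-- swapping the letters in positions j, j+1.  Consequently the one-line
-- notation of w s_i is that of w with the LETTERS i and i+1 interchanged.
swapLetter : ℕ → ℕ → ℕ
swapLetter i x = if does (x ℕ.≟ i) then suc i else (if does (x ℕ.≟ suc i) then i else x)

swapAt : ℕ → Word → Word
swapAt i w = map (swapLetter i) w

-- ℓ(w s_i) > ℓ(w)  iff  the letter i occurs before the letter i+1 in w
ascentAt : ℕ → Word → Bool
ascentAt i [] = false
ascentAt i (x ∷ w) = if does (x ℕ.≟ i) then true else (if does (x ℕ.≟ suc i) then false else ascentAt i w)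

-- generator s_{i+1} of 𝔖ₙ indexed by i : Fin (n ∸ 1), so s_1, …, s_{n-1}
gen : {n : ℕ} → Fin (n ∸ 1) → ℕ
gen i = suc (toℕ i)

-- The Hecke algebra Hₙ(q), as the free ℤ[q^{±1/2}]-module with basis
-- {T_w : w ∈ 𝔖ₙ}; an element is a formal sum  Σ c · T_w  (list of (c , w)).
-- Right multiplication by T_{s_i}:
--   T_w T_s = T_{ws}                     if ℓ(ws) > ℓ(w)
--   T_w T_s = (q-1) T_w + q T_{ws}       if ℓ(ws) < ℓ(w)

Hecke : Set
Hecke = List (Laurent × Word)

mulT : ℕ → Hecke → Hecke
mulT i = concatMap (λ { (c , w) →
  if ascentAt i w
  then (c , swapAt i w) ∷ []
  else (c *L qMinus1 , w) ∷ (c *L qL , swapAt i w) ∷ [] })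

mulOnePlusT : ℕ → Hecke → Hecke
mulOnePlusT i h = h ++ mulT i h

heckeProduct : (n : ℕ) → List ℕ → Hecke
heckeProduct n is = foldl (λ h i → mulOnePlusT i h) ((1L , idWord n) ∷ []) is

-- the ℤ[q^{±1/2}]-linear function Hₙ(q) → ℤ[q^{±1/2}] with T_w ↦ θ w
applyLinear : (Word → Laurent) → Hecke → Laurent
applyLinear θ h = sumL (map (λ { (c , w) → c *L θ w }) h)

-- The wiring diagram G of s_{a₁} ⋯ s_{a_m} (a_j the level i_j) and the
-- algebra Z_G.  The variable z_{h,j,k} is the triple (h , j , k)
-- (h a level 1..n, j a crossing 1..m, k ∈ {1,2}).

Var : Set
Var = ℕ × ℕ × ℕ

onCrossing : ℕ → ℕ → Bool
onCrossing h a = does (h ℕ.≟ a) ∨ does (h ℕ.≟ suc a)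

-- all paths starting at level h, entering elementary diagram G_j,
-- through the diagrams with crossing levels as; each given with its
-- weight word (edge variables in traversal order) and final sink level
paths : ℕ → ℕ → List ℕ → List (List Var × ℕ)
paths h j [] = ([] , h) ∷ []
paths h j (a ∷ as) =
  if onCrossing h a
  then concatMap (λ h' → map (λ { (p , e) → ((h , j , 1) ∷ (h' , j , 2) ∷ p , e) })
                              (paths h' (suc j) as))
                 (a ∷ suc a ∷ [])
  else paths h (suc j) as

-- elements of Z_G as formal sums of words in the variables
ZG : Set
ZG = List (Laurent × List Var)

infixl 7 _*Z_
_*Z_ : ZG → ZG → ZG
f *Z g = concatMap (λ { (c , u) → map (λ { (d , v) → (c *L d , u ++ v) }) g }) f

oneZ : ZG
oneZ = (1L , []) ∷ []

-- b_{i,j}: sum of weights of paths from source i to sink j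
pathEntry : List ℕ → ℕ → ℕ → ZG
pathEntry as i j = concatMap (λ { (p , e) → if does (e ℕ.≟ j) then (1L , p) ∷ [] else [] })
                             (paths i 1 as)

bProductFrom : List ℕ → ℕ → Word → ZG
bProductFrom as i [] = oneZ
bProductFrom as i (x ∷ v) = pathEntry as i x *Z bProductFrom as (suc i) v

bProduct : List ℕ → Word → ZG
bProduct as v = bProductFrom as 1 v

ltV : Var → Var → Bool
ltV (h , j , k) (h' , j' , k') =
  does (h ℕ.<? h') ∨ (does (h ℕ.≟ h') ∧ (does (j ℕ.<? j') ∨ (does (j ℕ.≟ j') ∧ does (k ℕ.<? k'))))

-- x = z_{h+1,j,k}, y = z_{h,j,k}: then x y = q^{1/2} y x; all other pairs commute
qPair : Var → Var → Bool
qPair (h , j , k) (h' , j' , k') = does (h ℕ.≟ suc h') ∧ does (j ℕ.≟ j') ∧ does (k ℕ.≟ k')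

-- x · m = t^e · m'  for a lexicographically ordered monomial m
insertV : Var → List Var → ℤ × List Var
insertV x [] = (+ 0 , x ∷ [])
insertV x (y ∷ m) with ltV y x
... | true  = let (e , m') = insertV x m
              in (e ℤ.+ (if qPair x y then + 1 else + 0) , y ∷ m')
... | false = (+ 0 , x ∷ y ∷ m)

-- a word equals t^e times a lexicographically ordered monomial
normal : List Var → ℤ × List Var
normal [] = (+ 0 , [])
normal (x ∷ w) = let (e , m) = normal w
                     (e' , m') = insertV x m
                 in (e ℤ.+ e' , m')

_≟Vs_ : (u v : List Var) → Relation.Nullary.Dec (u ≡ v)
_≟Vs_ = LP.≡-dec (PP.≡-dec ℕ._≟_ (PP.≡-dec ℕ._≟_ ℕ._≟_))

indexed : ℕ → List ℕ → List (ℕ × ℕ)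
indexed j [] = []
indexed j (a ∷ as) = (j , a) ∷ indexed (suc j) as

-- z_G: the product of all 4m variables in lexicographic order
zG : (n : ℕ) → List ℕ → List Var
zG n as = concatMap (λ h → concatMap (λ { (j , a) →
                      if onCrossing h a then (h , j , 1) ∷ (h , j , 2) ∷ [] else [] })
                                     (indexed 1 as))
                    (idWord n)

coeffZG : List Var → ZG → Laurent
coeffZG z f = sumL (map (λ { (c , w) → let (e , m) = normal w in
                               if does (m ≟Vs z) then c *L tpow e else 0L }) f)

-- 𝒜_{[n],[n]} with basis {x^{e,v}}: an element is a formal sum Σ c · x^{e,v}.

AElem : Set
AElem = List (Laurent × Word)

-- σ_B(x^{e,v}) = [z_G] b_{1,v₁} ⋯ b_{n,vₙ}, extended linearly
sigmaB : (n : ℕ) → List ℕ → AElem → Laurent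
sigmaB n as f = sumL (map (λ { (c , v) → c *L coeffZG (zG n as) (bProduct as v) }) f)

Imm : (n : ℕ) → (Word → Laurent) → AElem
Imm n θ = map (λ w → (θ w *L tpow (ℤ.- (+ len w)) , w)) (perms n)

-- Both sides obey the same recursion along the expression s_{i₁} ⋯ s_{i_m}.  On the Hecke side,
-- θ(T_w (1 + T_{s_a}) ⋯) is θ(T_w ⋯) + θ(T_{w s_a} ⋯) when ℓ(w s_a) > ℓ(w), and q times that
-- sum otherwise.  On the path side, expand b_{1,v₁} ⋯ b_{n,vₙ} as a sum over families of paths
-- and take the coefficient of z_G crossing by crossing: the variables of different crossings
-- commute, so the normal-ordering exponent splits.  At a crossing on levels a, a+1 exactly two
-- paths pass; if both leave at the same level a variable repeats and z_G is missed, otherwise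
-- they go straight or swap, with weights 1 and q^{1/2} (ascent) or q and q^{1/2} (descent).
-- Weighting by q^{-ℓ(v)/2} and using ℓ(w s_a) = ℓ(w) ± 1 turns this into the Hecke recursion.

module Submission where

open import Defs
open import Data.Bool using (Bool; true; false; if_then_else_; _∧_; _∨_)
open import Data.Bool.Properties using () renaming (_≟_ to _≟ᵇ_)
open import Data.Empty using (⊥; ⊥-elim)
open import Data.Fin using (Fin)
import Data.Fin.Properties as FP
open import Data.Integer as ℤ using (ℤ; +_)
import Data.Integer.Properties as ℤP
import Data.Integer.Tactic.RingSolver as ℤ-Solver
open import Data.List using (List; []; _∷_; _++_; [_]; map; concatMap; foldl; filter; length; applyUpTo; upTo)
import Data.List.Properties as LP
open import Data.List.Membership.Propositional using (_∈_; _∉_; find; lose)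
open import Data.List.Membership.Propositional.Properties
  using (∈-++⁻; ∈-++⁺ʳ; ∈-∃++; ∈-map⁻; ∈-map⁺; ∈-concatMap⁻; ∈-concatMap⁺; ∈-upTo⁺; ∈-upTo⁻)
open import Data.List.Relation.Binary.Permutation.Propositional
  using (_↭_; prep; swap; ↭-refl; ↭-reflexive; ↭-sym; ↭-trans; ↭⇒↭ₛ)
open import Data.List.Relation.Binary.Permutation.Propositional.Properties
  using (All-resp-↭; ∈-resp-↭; ↭-length; ↭-empty-inv; ¬x∷xs↭[]; drop-∷; drop-mid; shift; ∷↭∷ʳ; filter-↭; ++⁺; ++⁺ˡ)
import Data.List.Relation.Binary.Permutation.Setoid.Properties as ↭ₛP
open import Data.List.Relation.Unary.All as All using (All; []; _∷_)
import Data.List.Relation.Unary.All.Properties as AllP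
open import Data.List.Relation.Unary.AllPairs as AllPairs using (AllPairs; []; _∷_)
import Data.List.Relation.Unary.AllPairs.Properties as AllPairsP
open import Data.List.Relation.Unary.Any as Any using (Any; here; there)
open import Data.List.Relation.Unary.Unique.Propositional using (Unique)
import Data.List.Relation.Unary.Unique.Propositional.Properties as UniqueP
open import Data.Nat as ℕ using (ℕ; zero; suc; _<_; _≤_; z≤n; s≤s; _∸_)
import Data.Nat.Properties as ℕP
import Data.Nat.Tactic.RingSolver as ℕ-Solver
open import Data.Product using (_×_; _,_; proj₁; proj₂; uncurry; Σ-syntax)
open import Data.Sum using (_⊎_; inj₁; inj₂)
open import Function using (id; _∘_)
open import Relation.Binary.Bundles using (Setoid)
open import Relation.Binary.Definitions using (tri<; tri≈; tri>)
open import Relation.Binary.PropositionalEquality hiding ([_])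
import Relation.Binary.Reasoning.Setoid as SetoidReasoning
open import Relation.Nullary using (Dec; does; yes; no; ¬_)
open import Relation.Nullary.Decidable using (dec-true; dec-false; ¬?)
import Relation.Unary as U

-- Laurent polynomials up to ≈

pairing : Laurent → (ℤ → ℤ) → ℤ
pairing [] f = + 0
pairing ((e , c) ∷ a) f = c ℤ.* f e ℤ.+ pairing a f

pairing-cong : ∀ a {f g : ℤ → ℤ} → (∀ x → f x ≡ g x) → pairing a f ≡ pairing a g
pairing-cong [] f≗g = refl
pairing-cong ((e , c) ∷ a) f≗g = cong₂ (λ u v → c ℤ.* u ℤ.+ v) (f≗g e) (pairing-cong a f≗g)

pairing-++ : ∀ a b f → pairing (a ++ b) f ≡ pairing a f ℤ.+ pairing b f
pairing-++ [] b f = sym (ℤP.+-identityˡ _)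
pairing-++ ((e , c) ∷ a) b f rewrite pairing-++ a b f = sym (ℤP.+-assoc (c ℤ.* f e) (pairing a f) (pairing b f))

pairing-+ : ∀ a f g → pairing a (λ x → f x ℤ.+ g x) ≡ pairing a f ℤ.+ pairing a g
pairing-+ [] f g = refl
pairing-+ ((e , c) ∷ a) f g rewrite pairing-+ a f g = ring c (f e) (g e) (pairing a f) (pairing a g)
  where
  ring : ∀ c x y u v → c ℤ.* (x ℤ.+ y) ℤ.+ (u ℤ.+ v) ≡ c ℤ.* x ℤ.+ u ℤ.+ (c ℤ.* y ℤ.+ v)
  ring = ℤ-Solver.solve-∀

pairing-scale : ∀ a k f → k ℤ.* pairing a f ≡ pairing a (λ x → k ℤ.* f x)
pairing-scale [] k f = ℤP.*-zeroʳ k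
pairing-scale ((e , c) ∷ a) k f rewrite sym (pairing-scale a k f) = ring k c (f e) (pairing a f)
  where
  ring : ∀ k c x u → k ℤ.* (c ℤ.* x ℤ.+ u) ≡ c ℤ.* (k ℤ.* x) ℤ.+ k ℤ.* u
  ring = ℤ-Solver.solve-∀

pairing-zero : ∀ a → pairing a (λ _ → + 0) ≡ + 0
pairing-zero [] = refl
pairing-zero ((e , c) ∷ a) rewrite pairing-zero a | ℤP.*-zeroʳ c = refl

pairing-swap : ∀ a b (g : ℤ → ℤ → ℤ) →
  pairing a (λ x → pairing b (g x)) ≡ pairing b (λ y → pairing a (λ x → g x y))
pairing-swap [] b g = sym (pairing-zero b)
pairing-swap ((e , c) ∷ a) b g =
  trans (cong₂ ℤ._+_ (pairing-scale b c (g e)) (pairing-swap a b g))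
        (sym (pairing-+ b (λ y → c ℤ.* g e y) (λ y → pairing a (λ x → g x y))))

indicator : ℤ → ℤ → ℤ
indicator e x = if does (x ℤ.≟ e) then + 1 else + 0

coeff≡pairing : ∀ a e → coeff a e ≡ pairing a (indicator e)
coeff≡pairing [] e = refl
coeff≡pairing ((e′ , c) ∷ a) e rewrite coeff≡pairing a e with does (e′ ℤ.≟ e)
... | true = cong (ℤ._+ pairing a (indicator e)) (sym (ℤP.*-identityʳ c))
... | false = cong (ℤ._+ pairing a (indicator e)) (sym (ℤP.*-zeroʳ c))

coeff-++ : ∀ a b e → coeff (a ++ b) e ≡ coeff a e ℤ.+ coeff b e
coeff-++ a b e rewrite coeff≡pairing (a ++ b) e | coeff≡pairing a e | coeff≡pairing b e =
  pairing-++ a b (indicator e)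

pairing-*L : ∀ a b f → pairing (a *L b) f ≡ pairing a (λ x → pairing b (λ y → f (x ℤ.+ y)))
pairing-*L [] b f = refl
pairing-*L ((e , c) ∷ a) b f = trans (pairing-++ (map _ b) (a *L b) f)
  (cong₂ ℤ._+_ (trans (scaled b) (sym (pairing-scale b c _))) (pairing-*L a b f))
  where
  ring : ∀ c d x → c ℤ.* d ℤ.* x ≡ d ℤ.* (c ℤ.* x)
  ring = ℤ-Solver.solve-∀
  scaled : ∀ b → pairing (map (λ { (e′ , d) → (e ℤ.+ e′ , c ℤ.* d) }) b) f ≡ pairing b (λ y → c ℤ.* f (e ℤ.+ y))
  scaled [] = refl
  scaled ((e′ , d) ∷ b) = cong₂ ℤ._+_ (ring c d (f (e ℤ.+ e′))) (scaled b)

indicator-shift : ∀ e x y → indicator e (x ℤ.+ y) ≡ indicator (e ℤ.- x) y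
indicator-shift e x y with (x ℤ.+ y) ℤ.≟ e | y ℤ.≟ (e ℤ.- x)
... | yes _ | yes _ = refl
... | no _ | no _ = refl
... | yes x+y≡e | no y≢e-x = ⊥-elim (y≢e-x (trans (sym (ring x y)) (cong (ℤ._- x) x+y≡e)))
  where
  ring : ∀ x y → x ℤ.+ y ℤ.- x ≡ y
  ring = ℤ-Solver.solve-∀
... | no x+y≢e | yes y≡e-x = ⊥-elim (x+y≢e (trans (cong (λ z → x ℤ.+ z) y≡e-x) (ring x e)))
  where
  ring : ∀ x e → x ℤ.+ (e ℤ.- x) ≡ e
  ring = ℤ-Solver.solve-∀

coeff-*L : ∀ a b e → coeff (a *L b) e ≡ pairing a (λ x → coeff b (e ℤ.- x))
coeff-*L a b e = trans (coeff≡pairing (a *L b) e) (trans (pairing-*L a b (indicator e))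
  (pairing-cong a (λ x → trans (pairing-cong b (indicator-shift e x)) (sym (coeff≡pairing b (e ℤ.- x))))))

infix 4 _≋_
record _≋_ (a b : Laurent) : Set where
  constructor mk
  field un : a ≈ b
open _≋_ public

≋-refl : ∀ {a} → a ≋ a
≋-refl = mk (λ e → refl)

≋-sym : ∀ {a b} → a ≋ b → b ≋ a
≋-sym (mk p) = mk (λ e → sym (p e))

≋-trans : ∀ {a b c} → a ≋ b → b ≋ c → a ≋ c
≋-trans (mk p) (mk q) = mk (λ e → trans (p e) (q e))

≡⇒≋ : ∀ {a b} → a ≡ b → a ≋ b
≡⇒≋ refl = ≋-refl

≋-setoid : Setoid _ _
≋-setoid = record
  { Carrier = Laurent ; _≈_ = _≋_
  ; isEquivalence = record { refl = ≋-refl ; sym = ≋-sym ; trans = ≋-trans } }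

module ≋-Reasoning = SetoidReasoning ≋-setoid

+L-cong : ∀ {a a′ b b′} → a ≋ a′ → b ≋ b′ → a +L b ≋ a′ +L b′
+L-cong {a} {a′} {b} {b′} (mk p) (mk q) = mk λ e →
  trans (coeff-++ a b e) (trans (cong₂ ℤ._+_ (p e) (q e)) (sym (coeff-++ a′ b′ e)))

+L-congˡ : ∀ a {b b′} → b ≋ b′ → a +L b ≋ a +L b′
+L-congˡ a = +L-cong (≋-refl {a})

+L-comm : ∀ a b → a +L b ≋ b +L a
+L-comm a b = mk λ e →
  trans (coeff-++ a b e) (trans (ℤP.+-comm (coeff a e) (coeff b e)) (sym (coeff-++ b a e)))

+L-assoc : ∀ a b c → (a +L b) +L c ≋ a +L (b +L c)
+L-assoc a b c = ≡⇒≋ (LP.++-assoc a b c)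

+L-identityʳ : ∀ a → a +L 0L ≋ a
+L-identityʳ a = ≡⇒≋ (LP.++-identityʳ a)

+L-interchange : ∀ a b c d → (a +L b) +L (c +L d) ≋ (a +L c) +L (b +L d)
+L-interchange a b c d = mk λ e → begin
  coeff ((a +L b) +L (c +L d)) e
    ≡⟨ trans (coeff-++ (a +L b) (c +L d) e) (cong₂ ℤ._+_ (coeff-++ a b e) (coeff-++ c d e)) ⟩
  (coeff a e ℤ.+ coeff b e) ℤ.+ (coeff c e ℤ.+ coeff d e)
    ≡⟨ ring (coeff a e) (coeff b e) (coeff c e) (coeff d e) ⟩
  (coeff a e ℤ.+ coeff c e) ℤ.+ (coeff b e ℤ.+ coeff d e)
    ≡⟨ sym (trans (coeff-++ (a +L c) (b +L d) e) (cong₂ ℤ._+_ (coeff-++ a c e) (coeff-++ b d e))) ⟩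
  coeff ((a +L c) +L (b +L d)) e ∎
  where
  open ≡-Reasoning
  ring : ∀ a b c d → (a ℤ.+ b) ℤ.+ (c ℤ.+ d) ≡ (a ℤ.+ c) ℤ.+ (b ℤ.+ d)
  ring = ℤ-Solver.solve-∀

*L-congʳ : ∀ a {b b′} → b ≋ b′ → a *L b ≋ a *L b′
*L-congʳ a {b} {b′} (mk p) = mk λ e →
  trans (coeff-*L a b e) (trans (pairing-cong a (λ x → p (e ℤ.- x))) (sym (coeff-*L a b′ e)))

*L-comm : ∀ a b → a *L b ≋ b *L a
*L-comm a b = mk λ e →
  trans (coeff≡pairing (a *L b) e) (trans (pairing-*L a b (indicator e)) (trans (pairing-swap a b _)
    (trans (pairing-cong b (λ y → pairing-cong a (λ x → cong (indicator e) (ℤP.+-comm x y))))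
           (sym (trans (coeff≡pairing (b *L a) e) (pairing-*L b a (indicator e)))))))

*L-congˡ : ∀ {a a′} b → a ≋ a′ → a *L b ≋ a′ *L b
*L-congˡ {a} {a′} b p = ≋-trans (*L-comm a b) (≋-trans (*L-congʳ b p) (*L-comm b a′))

*L-assoc : ∀ a b c → (a *L b) *L c ≋ a *L (b *L c)
*L-assoc a b c = mk λ e →
  trans (coeff-*L (a *L b) c e) (trans (pairing-*L a b _)
    (trans (pairing-cong a (λ x → pairing-cong b (λ y → cong (coeff c) (ring e x y))))
           (sym (trans (coeff-*L a (b *L c) e) (pairing-cong a (λ x → coeff-*L b c (e ℤ.- x)))))))
  where
  ring : ∀ e x y → e ℤ.- (x ℤ.+ y) ≡ e ℤ.- x ℤ.- y
  ring = ℤ-Solver.solve-∀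

*L-distribʳ : ∀ a b c → (a +L b) *L c ≋ a *L c +L b *L c
*L-distribʳ a b c = mk λ e →
  trans (coeff-*L (a +L b) c e) (trans (pairing-++ a b _)
    (sym (trans (coeff-++ (a *L c) (b *L c) e) (cong₂ ℤ._+_ (coeff-*L a c e) (coeff-*L b c e)))))

*L-distribˡ : ∀ a b c → a *L (b +L c) ≋ a *L b +L a *L c
*L-distribˡ a b c = ≋-trans (*L-comm a (b +L c))
  (≋-trans (*L-distribʳ b c a) (+L-cong (*L-comm b a) (*L-comm c a)))

*L-identityˡ : ∀ a → 1L *L a ≋ a
*L-identityˡ a = mk λ e → trans (coeff-*L 1L a e)
  (trans (ℤP.+-identityʳ _) (trans (ℤP.*-identityˡ _) (cong (coeff a) (ℤP.+-identityʳ e))))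

*L-identityʳ : ∀ a → a *L 1L ≋ a
*L-identityʳ a = ≋-trans (*L-comm a 1L) (*L-identityˡ a)

*L-zeroʳ : ∀ a → a *L 0L ≋ 0L
*L-zeroʳ a = *L-comm a 0L

*L-left-comm : ∀ a b c → a *L (b *L c) ≋ b *L (a *L c)
*L-left-comm a b c =
  ≋-trans (≋-sym (*L-assoc a b c)) (≋-trans (*L-congˡ c (*L-comm a b)) (*L-assoc b a c))

tpow-*L : ∀ x y c → tpow x *L (tpow y *L c) ≋ tpow (x ℤ.+ y) *L c
tpow-*L x y c = ≋-sym (*L-assoc (tpow x) (tpow y) c)

1+[q-1]≋q : 1L +L qMinus1 ≋ qL
1+[q-1]≋q = mk λ e → lemma e
  where
  lemma : ∀ e → coeff (1L +L qMinus1) e ≡ coeff qL e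
  lemma e with does (+ 0 ℤ.≟ e) | does (+ 2 ℤ.≟ e)
  ... | true | true = refl
  ... | true | false = refl
  ... | false | true = refl
  ... | false | false = refl

∑ : ∀ {A : Set} → (A → Laurent) → List A → Laurent
∑ F xs = sumL (map F xs)

∑-++ : ∀ {A : Set} (F : A → Laurent) xs ys → ∑ F (xs ++ ys) ≋ ∑ F xs +L ∑ F ys
∑-++ F [] ys = ≋-refl
∑-++ F (x ∷ xs) ys =
  ≋-trans (+L-congˡ (F x) (∑-++ F xs ys)) (≋-sym (+L-assoc (F x) (∑ F xs) (∑ F ys)))

∑-cong : ∀ {A : Set} {F G : A → Laurent} xs → (∀ x → F x ≋ G x) → ∑ F xs ≋ ∑ G xs
∑-cong [] F≋G = ≋-refl
∑-cong (x ∷ xs) F≋G = +L-cong (F≋G x) (∑-cong xs F≋G)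

∑-congᴬ : ∀ {A : Set} {F G : A → Laurent} {xs} → All (λ x → F x ≋ G x) xs → ∑ F xs ≋ ∑ G xs
∑-congᴬ [] = ≋-refl
∑-congᴬ (p ∷ ps) = +L-cong p (∑-congᴬ ps)

∑-map : ∀ {A B : Set} (F : B → Laurent) (g : A → B) xs → ∑ F (map g xs) ≋ ∑ (F ∘ g) xs
∑-map F g xs = ≡⇒≋ (cong sumL (sym (LP.map-∘ xs)))

∑-concatMap : ∀ {A B : Set} (F : B → Laurent) (g : A → List B) xs →
  ∑ F (concatMap g xs) ≋ ∑ (λ x → ∑ F (g x)) xs
∑-concatMap F g [] = ≋-refl
∑-concatMap F g (x ∷ xs) = ≋-trans (∑-++ F (g x) (concatMap g xs)) (+L-congˡ (∑ F (g x)) (∑-concatMap F g xs))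

*L-∑ : ∀ {A : Set} c (F : A → Laurent) xs → c *L ∑ F xs ≋ ∑ (λ x → c *L F x) xs
*L-∑ c F [] = *L-zeroʳ c
*L-∑ c F (x ∷ xs) = ≋-trans (*L-distribˡ c (F x) (∑ F xs)) (+L-congˡ (c *L F x) (*L-∑ c F xs))

∑-+ : ∀ {A : Set} (F G : A → Laurent) xs → ∑ (λ x → F x +L G x) xs ≋ ∑ F xs +L ∑ G xs
∑-+ F G [] = ≋-refl
∑-+ F G (x ∷ xs) =
  ≋-trans (+L-congˡ (F x +L G x) (∑-+ F G xs)) (+L-interchange (F x) (G x) (∑ F xs) (∑ G xs))

∑-zero : ∀ {A : Set} {F : A → Laurent} xs → All (λ x → F x ≋ 0L) xs → ∑ F xs ≋ 0L
∑-zero [] [] = ≋-refl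
∑-zero (x ∷ xs) (p ∷ ps) = +L-cong p (∑-zero xs ps)

∑-comm : ∀ {A B : Set} (F : A → B → Laurent) xs ys →
  ∑ (λ x → ∑ (F x) ys) xs ≋ ∑ (λ y → ∑ (λ x → F x y) xs) ys
∑-comm F [] ys = ≋-sym (∑-zero ys (All.universal (λ _ → ≋-refl) ys))
∑-comm F (x ∷ xs) ys = ≋-trans (+L-congˡ (∑ (F x) ys) (∑-comm F xs ys))
  (≋-sym (∑-+ (F x) (λ y → ∑ (λ x → F x y) xs) ys))

-- The Hecke side

evalProduct : (Word → Laurent) → List ℕ → Word → Laurent
evalProduct θ [] w = θ w
evalProduct θ (a ∷ as) w with ascentAt a w
... | true = evalProduct θ as w +L evalProduct θ as (swapAt a w)
... | false = qL *L evalProduct θ as w +L qL *L evalProduct θ as (swapAt a w)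

evalTerm : (Word → Laurent) → List ℕ → Laurent × Word → Laurent
evalTerm θ as (c , w) = c *L evalProduct θ as w

mulTTerm : ℕ → Laurent × Word → Hecke
mulTTerm a (c , w) =
  if ascentAt a w then (c , swapAt a w) ∷ [] else (c *L qMinus1 , w) ∷ (c *L qL , swapAt a w) ∷ []

evalTerm-mulOnePlusT : ∀ θ a as c w →
  evalTerm θ as (c , w) +L ∑ (evalTerm θ as) (mulTTerm a (c , w)) ≋ evalTerm θ (a ∷ as) (c , w)
evalTerm-mulOnePlusT θ a as c w with ascentAt a w
... | true = ≋-trans (+L-congˡ (c *L X) (+L-identityʳ (c *L Y))) (≋-sym (*L-distribˡ c X Y))
  where
  X Y : Laurent
  X = evalProduct θ as w
  Y = evalProduct θ as (swapAt a w)
... | false = begin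
  c *L X +L (c *L qMinus1 *L X +L (c *L qL *L Y +L 0L))
    ≈⟨ +L-congˡ (c *L X) (+L-congˡ (c *L qMinus1 *L X) (+L-identityʳ _)) ⟩
  c *L X +L (c *L qMinus1 *L X +L c *L qL *L Y)
    ≈⟨ ≋-sym (+L-assoc (c *L X) _ _) ⟩
  (c *L X +L c *L qMinus1 *L X) +L c *L qL *L Y
    ≈⟨ +L-cong (+L-cong (≋-sym (*L-congʳ c (*L-identityˡ X))) (*L-assoc c qMinus1 X)) (*L-assoc c qL Y) ⟩
  (c *L (1L *L X) +L c *L (qMinus1 *L X)) +L c *L (qL *L Y)
    ≈⟨ +L-cong (≋-sym (≋-trans (*L-congʳ c (*L-distribʳ 1L qMinus1 X)) (*L-distribˡ c _ _))) ≋-refl ⟩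
  c *L ((1L +L qMinus1) *L X) +L c *L (qL *L Y)
    ≈⟨ +L-cong (*L-congʳ c (*L-congˡ X 1+[q-1]≋q)) ≋-refl ⟩
  c *L (qL *L X) +L c *L (qL *L Y)
    ≈⟨ ≋-sym (*L-distribˡ c _ _) ⟩
  c *L (qL *L X +L qL *L Y) ∎
  where
  open ≋-Reasoning
  X Y : Laurent
  X = evalProduct θ as w
  Y = evalProduct θ as (swapAt a w)

applyLinear-foldl : ∀ θ as h →
  applyLinear θ (foldl (λ h a → mulOnePlusT a h) h as) ≋ ∑ (evalTerm θ as) h
applyLinear-foldl θ [] h = ≋-refl
applyLinear-foldl θ (a ∷ as) h = begin
  applyLinear θ (foldl (λ h a → mulOnePlusT a h) (h ++ mulT a h) as)
    ≈⟨ applyLinear-foldl θ as (h ++ mulT a h) ⟩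
  ∑ (evalTerm θ as) (h ++ mulT a h)
    ≈⟨ ≋-trans (∑-++ (evalTerm θ as) h (mulT a h)) (+L-congˡ _ (∑-concatMap (evalTerm θ as) _ h)) ⟩
  ∑ (evalTerm θ as) h +L ∑ (λ cw → ∑ (evalTerm θ as) (mulTTerm a cw)) h
    ≈⟨ ≋-sym (∑-+ (evalTerm θ as) _ h) ⟩
  ∑ (λ cw → evalTerm θ as cw +L ∑ (evalTerm θ as) (mulTTerm a cw)) h
    ≈⟨ ∑-cong h (λ { (c , w) → evalTerm-mulOnePlusT θ a as c w }) ⟩
  ∑ (evalTerm θ (a ∷ as)) h ∎
  where open ≋-Reasoning

-- Normal ordering in Z_G

∨-true : ∀ {a b} → a ∨ b ≡ true → a ≡ true ⊎ b ≡ true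
∨-true {true} p = inj₁ refl
∨-true {false} p = inj₂ p

∧-true : ∀ {a b} → a ∧ b ≡ true → a ≡ true × b ≡ true
∧-true {true} p = refl , p

does-true : ∀ {P : Set} (d : Dec P) → does d ≡ true → P
does-true (yes p) _ = p

≢true⇒≡false : ∀ {b} → ¬ (b ≡ true) → b ≡ false
≢true⇒≡false {true} p = ⊥-elim (p refl)
≢true⇒≡false {false} p = refl

infix 4 _<ᵛ_ _≤ᵛ_
data _<ᵛ_ : Var → Var → Set where
  level< : ∀ {h j k h′ j′ k′} → h < h′ → (h , j , k) <ᵛ (h′ , j′ , k′)
  crossing< : ∀ {h j k j′ k′} → j < j′ → (h , j , k) <ᵛ (h , j′ , k′)
  end< : ∀ {h j k k′} → k < k′ → (h , j , k) <ᵛ (h , j , k′)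

_≤ᵛ_ : Var → Var → Set
x ≤ᵛ y = ¬ (y <ᵛ x)

ltV⇒<ᵛ : ∀ x y → ltV x y ≡ true → x <ᵛ y
ltV⇒<ᵛ (h , j , k) (h′ , j′ , k′) p with ∨-true {does (h ℕ.<? h′)} p
... | inj₁ q = level< (does-true (h ℕ.<? h′) q)
... | inj₂ q with ∧-true {does (h ℕ.≟ h′)} q
... | q₁ , q₂ with does-true (h ℕ.≟ h′) q₁
... | refl with ∨-true {does (j ℕ.<? j′)} q₂
... | inj₁ r = crossing< (does-true (j ℕ.<? j′) r)
... | inj₂ r with ∧-true {does (j ℕ.≟ j′)} r
... | r₁ , r₂ with does-true (j ℕ.≟ j′) r₁
... | refl = end< (does-true (k ℕ.<? k′) r₂)

<ᵛ⇒ltV : ∀ {x y} → x <ᵛ y → ltV x y ≡ true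
<ᵛ⇒ltV {h , j , k} {h′ , j′ , k′} (level< p) rewrite dec-true (h ℕ.<? h′) p = refl
<ᵛ⇒ltV {h , j , k} {.h , j′ , k′} (crossing< p)
  rewrite dec-false (h ℕ.<? h) (ℕP.<-irrefl refl) | dec-true (h ℕ.≟ h) refl | dec-true (j ℕ.<? j′) p = refl
<ᵛ⇒ltV {h , j , k} {.h , .j , k′} (end< p)
  rewrite dec-false (h ℕ.<? h) (ℕP.<-irrefl refl) | dec-true (h ℕ.≟ h) refl
        | dec-false (j ℕ.<? j) (ℕP.<-irrefl refl) | dec-true (j ℕ.≟ j) refl | dec-true (k ℕ.<? k′) p = refl

ltV≡false⇒≤ᵛ : ∀ {x y} → ltV y x ≡ false → x ≤ᵛ y
ltV≡false⇒≤ᵛ eq y<x with trans (sym (<ᵛ⇒ltV y<x)) eq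
... | ()

<ᵛ-irrefl : ∀ {x} → ¬ (x <ᵛ x)
<ᵛ-irrefl (level< p) = ℕP.<-irrefl refl p
<ᵛ-irrefl (crossing< p) = ℕP.<-irrefl refl p
<ᵛ-irrefl (end< p) = ℕP.<-irrefl refl p

<ᵛ-trans : ∀ {x y z} → x <ᵛ y → y <ᵛ z → x <ᵛ z
<ᵛ-trans (level< p) (level< q) = level< (ℕP.<-trans p q)
<ᵛ-trans (level< p) (crossing< q) = level< p
<ᵛ-trans (level< p) (end< q) = level< p
<ᵛ-trans (crossing< p) (level< q) = level< q
<ᵛ-trans (crossing< p) (crossing< q) = crossing< (ℕP.<-trans p q)
<ᵛ-trans (crossing< p) (end< q) = crossing< p
<ᵛ-trans (end< p) (level< q) = level< q
<ᵛ-trans (end< p) (crossing< q) = crossing< q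
<ᵛ-trans (end< p) (end< q) = end< (ℕP.<-trans p q)

<ᵛ-asym : ∀ {x y} → x <ᵛ y → x ≤ᵛ y
<ᵛ-asym p q = <ᵛ-irrefl (<ᵛ-trans p q)

<ᵛ-cmp : ∀ x y → x <ᵛ y ⊎ x ≡ y ⊎ y <ᵛ x
<ᵛ-cmp (h , j , k) (h′ , j′ , k′) with ℕP.<-cmp h h′
... | tri< a _ _ = inj₁ (level< a)
... | tri> _ _ c = inj₂ (inj₂ (level< c))
... | tri≈ _ refl _ with ℕP.<-cmp j j′
... | tri< a _ _ = inj₁ (crossing< a)
... | tri> _ _ c = inj₂ (inj₂ (crossing< c))
... | tri≈ _ refl _ with ℕP.<-cmp k k′
... | tri< a _ _ = inj₁ (end< a)
... | tri> _ _ c = inj₂ (inj₂ (end< c))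
... | tri≈ _ refl _ = inj₂ (inj₁ refl)

≤ᵛ-trans : ∀ {x y z} → x ≤ᵛ y → y ≤ᵛ z → x ≤ᵛ z
≤ᵛ-trans {x} {y} x≤y y≤z z<x with <ᵛ-cmp y x
... | inj₁ y<x = x≤y y<x
... | inj₂ (inj₁ refl) = y≤z z<x
... | inj₂ (inj₂ x<y) = y≤z (<ᵛ-trans z<x x<y)

qPair⇒<ᵛ : ∀ x y → qPair x y ≡ true → y <ᵛ x
qPair⇒<ᵛ (h , j , k) (h′ , j′ , k′) p with does-true (h ℕ.≟ suc h′) (proj₁ (∧-true {does (h ℕ.≟ suc h′)} p))
... | refl = level< (ℕP.n<1+n h′)

count : ∀ {A : Set} → (A → Bool) → List A → ℕ
count p [] = 0
count p (x ∷ xs) = count p xs ℕ.+ (if p x then 1 else 0)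

count-↭ : ∀ {A : Set} (p : A → Bool) {xs ys} → xs ↭ ys → count p xs ≡ count p ys
count-↭ p {xs} {ys} xs↭ys =
  trans (count≡length xs) (trans (↭-length (filter-↭ (λ x → p x ≟ᵇ true) xs↭ys)) (sym (count≡length ys)))
  where
  count≡length : ∀ xs → count p xs ≡ length (filter (λ x → p x ≟ᵇ true) xs)
  count≡length [] = refl
  count≡length (x ∷ xs) with p x
  ... | true = trans (ℕP.+-comm (count p xs) 1) (cong suc (count≡length xs))
  ... | false = trans (ℕP.+-identityʳ (count p xs)) (count≡length xs)

count-none : ∀ {A : Set} (p : A → Bool) xs → All (λ x → p x ≡ false) xs → count p xs ≡ 0
count-none p [] [] = refl
count-none p (x ∷ xs) (px ∷ ps) rewrite count-none p xs ps | px = refl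

qInversions : List Var → ℕ
qInversions [] = 0
qInversions (x ∷ w) = qInversions w ℕ.+ count (qPair x) w

SortedVars : List Var → Set
SortedVars = AllPairs _≤ᵛ_

insertV-exponent : ∀ x m → SortedVars m → proj₁ (insertV x m) ≡ + count (qPair x) m
insertV-↭ : ∀ x m → SortedVars m → proj₂ (insertV x m) ↭ x ∷ m
insertV-sorted : ∀ x m → SortedVars m → SortedVars (proj₂ (insertV x m))

insertV-exponent x [] s = refl
insertV-exponent x (y ∷ m) (y≤m ∷ s) with ltV y x in eq
... | true rewrite insertV-exponent x m s with qPair x y
... | true = refl
... | false = refl
insertV-exponent x (y ∷ m) (y≤m ∷ s) | false =
  sym (cong +_ (count-none (qPair x) (y ∷ m) (noPair x≤y ∷ All.map (noPair ∘ ≤ᵛ-trans x≤y) y≤m)))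
  where
  x≤y : x ≤ᵛ y
  x≤y = ltV≡false⇒≤ᵛ eq
  noPair : ∀ {z} → x ≤ᵛ z → qPair x z ≡ false
  noPair x≤z = ≢true⇒≡false (x≤z ∘ qPair⇒<ᵛ x _)

insertV-↭ x [] s = ↭-refl
insertV-↭ x (y ∷ m) (_ ∷ s) with ltV y x
... | true = ↭-trans (prep y (insertV-↭ x m s)) (swap y x ↭-refl)
... | false = ↭-refl

insertV-sorted x [] s = [] ∷ []
insertV-sorted x (y ∷ m) (y≤m ∷ s) with ltV y x in eq
... | true = All-resp-↭ (↭-sym (insertV-↭ x m s)) (<ᵛ-asym (ltV⇒<ᵛ y x eq) ∷ y≤m) ∷ insertV-sorted x m s
... | false = (x≤y ∷ All.map (≤ᵛ-trans x≤y) y≤m) ∷ y≤m ∷ s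
  where
  x≤y : x ≤ᵛ y
  x≤y = ltV≡false⇒≤ᵛ eq

normal-exponent : ∀ w → proj₁ (normal w) ≡ + qInversions w
normal-↭ : ∀ w → proj₂ (normal w) ↭ w
normal-sorted : ∀ w → SortedVars (proj₂ (normal w))

normal-exponent [] = refl
normal-exponent (x ∷ w)
  rewrite normal-exponent w | insertV-exponent x (proj₂ (normal w)) (normal-sorted w)
        | count-↭ (qPair x) (normal-↭ w) = refl

normal-↭ [] = ↭-refl
normal-↭ (x ∷ w) = ↭-trans (insertV-↭ x (proj₂ (normal w)) (normal-sorted w)) (prep x (normal-↭ w))

normal-sorted [] = []
normal-sorted (x ∷ w) = insertV-sorted x (proj₂ (normal w)) (normal-sorted w)

sorted↭strictlySorted⇒≡ : ∀ {m z} → SortedVars m → AllPairs _<ᵛ_ z → m ↭ z → m ≡ z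
sorted↭strictlySorted⇒≡ {[]} s t p = sym (↭-empty-inv (↭-sym p))
sorted↭strictlySorted⇒≡ {x ∷ m} {[]} s t p = ⊥-elim (¬x∷xs↭[] p)
sorted↭strictlySorted⇒≡ {x ∷ m} {y ∷ z} (x≤m ∷ s) (y<z ∷ t) p
  with ∈-resp-↭ (↭-sym p) (here refl) | ∈-resp-↭ p (here refl)
... | here refl | _ = cong (x ∷_) (sorted↭strictlySorted⇒≡ s t (drop-∷ p))
... | there y∈m | here refl = cong (x ∷_) (sorted↭strictlySorted⇒≡ s t (drop-∷ p))
... | there y∈m | there x∈z = ⊥-elim (All.lookup x≤m y∈m (All.lookup y<z x∈z))

zCoeff : List Var → List Var → Laurent
zCoeff z w = if does (proj₂ (normal w) ≟Vs z) then tpow (proj₁ (normal w)) else 0L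

normal≡⇒↭ : ∀ w {z} → proj₂ (normal w) ≡ z → w ↭ z
normal≡⇒↭ w refl = ↭-sym (normal-↭ w)

zCoeff-↭ : ∀ {z} w → AllPairs _<ᵛ_ z → w ↭ z → zCoeff z w ≡ tpow (+ qInversions w)
zCoeff-↭ {z} w t w↭z
  rewrite sorted↭strictlySorted⇒≡ (normal-sorted w) t (↭-trans (normal-↭ w) w↭z)
        | dec-true (z ≟Vs z) refl = cong tpow (normal-exponent w)

zCoeff-¬↭ : ∀ {z} w → ¬ (w ↭ z) → zCoeff z w ≡ 0L
zCoeff-¬↭ {z} w ¬w↭z with proj₂ (normal w) ≟Vs z
... | yes eq = ⊥-elim (¬w↭z (normal≡⇒↭ w eq))
... | no _ = refl

-- If no q-commuting pair straddles P, the coefficient [z] w factors over P and ¬ P.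
module SplitBy {P : Var → Set} (P? : U.Decidable P)
  (qPair-resp : ∀ x y → qPair x y ≡ true → (P x → P y) × (P y → P x)) where

  inside outside : List Var → List Var
  inside = filter P?
  outside = filter (¬? ∘ P?)

  ↭-inside++outside : ∀ w → w ↭ inside w ++ outside w
  ↭-inside++outside [] = ↭-refl
  ↭-inside++outside (x ∷ w) with P? x
  ... | yes _ = prep x (↭-inside++outside w)
  ... | no _ = ↭-trans (prep x (↭-inside++outside w)) (↭-sym (shift x (inside w) (outside w)))

  count-split : ∀ p w → count p w ≡ count p (inside w) ℕ.+ count p (outside w)
  count-split p [] = refl
  count-split p (x ∷ w) with P? x
  ... | yes _ rewrite count-split p w = ring (count p (inside w)) (count p (outside w)) (if p x then 1 else 0)
    where
    ring : ∀ a b c → a ℕ.+ b ℕ.+ c ≡ a ℕ.+ c ℕ.+ b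
    ring = ℕ-Solver.solve-∀
  ... | no _ rewrite count-split p w = ℕP.+-assoc (count p (inside w)) (count p (outside w)) _

  all-inside : ∀ w → All P (inside w)
  all-inside [] = []
  all-inside (x ∷ w) with P? x
  ... | yes p = p ∷ all-inside w
  ... | no _ = all-inside w

  none-outside : ∀ w → All (¬_ ∘ P) (outside w)
  none-outside [] = []
  none-outside (x ∷ w) with P? x
  ... | yes _ = none-outside w
  ... | no ¬p = ¬p ∷ none-outside w

  qInversions-split : ∀ w → qInversions w ≡ qInversions (inside w) ℕ.+ qInversions (outside w)
  qInversions-split [] = refl
  qInversions-split (x ∷ w) with P? x
  ... | yes px rewrite qInversions-split w | count-split (qPair x) w
      | count-none (qPair x) (outside w) (All.map (λ ¬py → ≢true⇒≡false (¬py ∘ λ q → proj₁ (qPair-resp x _ q) px)) (none-outside w)) =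
        ring (qInversions (inside w)) (qInversions (outside w)) (count (qPair x) (inside w))
    where
    ring : ∀ a b c → a ℕ.+ b ℕ.+ (c ℕ.+ 0) ≡ a ℕ.+ c ℕ.+ b
    ring = ℕ-Solver.solve-∀
  ... | no ¬px rewrite qInversions-split w | count-split (qPair x) w
      | count-none (qPair x) (inside w) (All.map (λ py → ≢true⇒≡false (λ q → ¬px (proj₂ (qPair-resp x _ q) py))) (all-inside w)) =
        ℕP.+-assoc (qInversions (inside w)) (qInversions (outside w)) _

  zCoeff-split : ∀ z w → AllPairs _<ᵛ_ z → zCoeff z w ≋ zCoeff (inside z) (inside w) *L zCoeff (outside z) (outside w)
  zCoeff-split z w t with proj₂ (normal w) ≟Vs z
  ... | yes eq = ≡⇒≋ (begin
      tpow (proj₁ (normal w))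
        ≡⟨ cong tpow (trans (normal-exponent w) (cong +_ (qInversions-split w))) ⟩
      tpow (+ qInversions (inside w)) *L tpow (+ qInversions (outside w))
        ≡⟨ sym (cong₂ _*L_ (zCoeff-↭ (inside w) (AllPairsP.filter⁺ P? t) (filter-↭ P? w↭z))
                           (zCoeff-↭ (outside w) (AllPairsP.filter⁺ _ t) (filter-↭ _ w↭z))) ⟩
      zCoeff (inside z) (inside w) *L zCoeff (outside z) (outside w) ∎)
    where
    open ≡-Reasoning
    w↭z = normal≡⇒↭ w eq
  ... | no ne with proj₂ (normal (inside w)) ≟Vs inside z | proj₂ (normal (outside w)) ≟Vs outside z
  ... | no _ | _ = ≋-refl
  ... | yes _ | no _ = ≋-sym (*L-zeroʳ (tpow (proj₁ (normal (inside w)))))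
  ... | yes e₁ | yes e₂ = ⊥-elim (ne (sorted↭strictlySorted⇒≡ (normal-sorted w) t (↭-trans (normal-↭ w) w↭z)))
    where
    w↭z : w ↭ z
    w↭z = ↭-trans (↭-inside++outside w) (↭-trans (++⁺ (normal≡⇒↭ (inside w) e₁) (normal≡⇒↭ (outside w) e₂)) (↭-sym (↭-inside++outside z)))


crossingVars : ℕ → ℕ × ℕ → List Var
crossingVars h (j , a) = if onCrossing h a then (h , j , 1) ∷ (h , j , 2) ∷ [] else []

levelVars : ℕ → ℕ → List ℕ → List Var
levelVars h j as = concatMap (crossingVars h) (indexed j as)

zGFrom : ℕ → ℕ → List ℕ → List Var
zGFrom n j as = concatMap (λ h → levelVars h j as) (idWord n)

crossingBlock : ℕ → ℕ → List Var
crossingBlock a j = (a , j , 1) ∷ (a , j , 2) ∷ (suc a , j , 1) ∷ (suc a , j , 2) ∷ []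

interval : ℕ → ℕ → List ℕ
interval i zero = []
interval i (suc k) = i ∷ interval (suc i) k

idWord≡interval : ∀ n → idWord n ≡ interval 1 n
idWord≡interval n = map-applyUpTo 1 n (λ _ → refl)
  where
  map-applyUpTo : ∀ i k {f : ℕ → ℕ} → (∀ x → suc (f x) ≡ i ℕ.+ x) → map suc (applyUpTo f k) ≡ interval i k
  map-applyUpTo i zero _ = refl
  map-applyUpTo i (suc k) f≗ = cong₂ _∷_ (trans (f≗ 0) (ℕP.+-identityʳ i))
    (map-applyUpTo (suc i) k (λ x → trans (f≗ (suc x)) (ℕP.+-suc i x)))
interval-++ : ∀ i k m → interval i (k ℕ.+ m) ≡ interval i k ++ interval (i ℕ.+ k) m
interval-++ i zero m = cong (λ t → interval t m) (sym (ℕP.+-identityʳ i))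
interval-++ i (suc k) m = cong (i ∷_) (trans (interval-++ (suc i) k m)
  (cong (λ t → interval (suc i) k ++ interval t m) (sym (ℕP.+-suc i k))))

crossingOf : Var → ℕ
crossingOf (_ , j , _) = j

atCrossing? : (j : ℕ) → U.Decidable (λ v → crossingOf v ≡ j)
atCrossing? j v = crossingOf v ℕ.≟ j

filter-concatMap : ∀ {A B : Set} {P : B → Set} (P? : U.Decidable P) (f : A → List B) xs →
  filter P? (concatMap f xs) ≡ concatMap (filter P? ∘ f) xs
filter-concatMap P? f [] = refl
filter-concatMap P? f (x ∷ xs) =
  trans (LP.filter-++ P? (f x) (concatMap f xs)) (cong (filter P? (f x) ++_) (filter-concatMap P? f xs))

concatMap-[] : ∀ {A B : Set} (xs : List A) → concatMap (λ (_ : A) → [] {A = B}) xs ≡ []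
concatMap-[] [] = refl
concatMap-[] (x ∷ xs) = concatMap-[] xs

levelVars-bounds : ∀ h j as → All (λ v → proj₁ v ≡ h × j ≤ crossingOf v) (levelVars h j as)
levelVars-bounds h j [] = []
levelVars-bounds h j (a ∷ as) =
  AllP.++⁺ first (All.map (λ (p , q) → p , ℕP.<⇒≤ q) (levelVars-bounds h (suc j) as))
  where
  first : All (λ v → proj₁ v ≡ h × j ≤ crossingOf v) (crossingVars h (j , a))
  first with onCrossing h a
  ... | true = (refl , ℕP.≤-refl) ∷ (refl , ℕP.≤-refl) ∷ []
  ... | false = []

crossingVars-crossing : ∀ h j a → All (λ v → crossingOf v ≡ j) (crossingVars h (j , a))
crossingVars-crossing h j a with onCrossing h a
... | true = refl ∷ refl ∷ []
... | false = []

levelVars-sorted : ∀ h j as → AllPairs _<ᵛ_ (levelVars h j as)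
levelVars-sorted h j [] = []
levelVars-sorted h j (a ∷ as) = AllPairsP.++⁺ first (levelVars-sorted h (suc j) as) first<rest
  where
  first : AllPairs _<ᵛ_ (crossingVars h (j , a))
  first with onCrossing h a
  ... | true = (end< (s≤s (s≤s z≤n)) ∷ []) ∷ [] ∷ []
  ... | false = []
  <rest : ∀ k → All ((h , j , k) <ᵛ_) (levelVars h (suc j) as)
  <rest k = All.map (λ { {_ , _ , _} (refl , q) → crossing< q }) (levelVars-bounds h (suc j) as)
  first<rest : All (λ x → All (x <ᵛ_) (levelVars h (suc j) as)) (crossingVars h (j , a))
  first<rest with onCrossing h a
  ... | true = <rest 1 ∷ <rest 2 ∷ []
  ... | false = []

zGFrom-sorted : ∀ n j as → AllPairs _<ᵛ_ (zGFrom n j as)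
zGFrom-sorted n j as rewrite idWord≡interval n = proj₁ (sorted-from 1 n)
  where
  sorted-from : ∀ i k → AllPairs _<ᵛ_ (concatMap (λ h → levelVars h j as) (interval i k))
                      × All (λ v → i ≤ proj₁ v) (concatMap (λ h → levelVars h j as) (interval i k))
  sorted-from i zero = [] , []
  sorted-from i (suc k) with sorted-from (suc i) k
  ... | sorted , above =
      AllPairsP.++⁺ (levelVars-sorted i j as) sorted
        (All.map (λ { (refl , _) → All.map (λ { {_ , _ , _} i<h → level< i<h }) above }) (levelVars-bounds i j as))
    , AllP.++⁺ (All.map (λ { (refl , _) → ℕP.≤-refl }) (levelVars-bounds i j as)) (All.map ℕP.<⇒≤ above)

zGFrom-[] : ∀ n j → zGFrom n j [] ≡ []
zGFrom-[] n j = concatMap-[] (idWord n)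

filter-laterCrossings : ∀ n j a as → filter (¬? ∘ atCrossing? j) (zGFrom n j (a ∷ as)) ≡ zGFrom n (suc j) as
filter-laterCrossings n j a as =
  trans (filter-concatMap (¬? ∘ atCrossing? j) _ (idWord n)) (LP.concatMap-cong perLevel (idWord n))
  where
  perLevel : ∀ h → filter (¬? ∘ atCrossing? j) (crossingVars h (j , a) ++ levelVars h (suc j) as) ≡ levelVars h (suc j) as
  perLevel h = trans (LP.filter-++ (¬? ∘ atCrossing? j) (crossingVars h (j , a)) (levelVars h (suc j) as))
    (cong₂ _++_ (LP.filter-none (¬? ∘ atCrossing? j) (All.map (λ e ne → ne e) (crossingVars-crossing h j a)))
                (LP.filter-all (¬? ∘ atCrossing? j) (All.map (λ { (_ , q) e → ℕP.<-irrefl (sym e) q }) (levelVars-bounds h (suc j) as))))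

onCrossing-false : ∀ h a → h ≢ a → h ≢ suc a → onCrossing h a ≡ false
onCrossing-false h a p q rewrite dec-false (h ℕ.≟ a) p | dec-false (h ℕ.≟ suc a) q = refl

crossingVars-off : ∀ h j a → h ≢ a → h ≢ suc a → crossingVars h (j , a) ≡ []
crossingVars-off h j a p q rewrite onCrossing-false h a p q = refl

crossingVars-below : ∀ j a i k → i ℕ.+ k ≤ a → concatMap (λ h → crossingVars h (j , a)) (interval i k) ≡ []
crossingVars-below j a i zero _ = refl
crossingVars-below j a i (suc k) i+k<a =
  cong₂ _++_ (crossingVars-off i j a (ℕP.<⇒≢ i<a) (ℕP.<⇒≢ (ℕP.m<n⇒m<1+n i<a)))
             (crossingVars-below j a (suc i) k (subst (_≤ a) (ℕP.+-suc i k) i+k<a))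
  where
  i<a : i < a
  i<a = ℕP.<-≤-trans (s≤s (ℕP.m≤m+n i k)) (subst (_≤ a) (ℕP.+-suc i k) i+k<a)

crossingVars-above : ∀ j a i k → suc a < i → concatMap (λ h → crossingVars h (j , a)) (interval i k) ≡ []
crossingVars-above j a i zero _ = refl
crossingVars-above j a i (suc k) 1+a<i =
  cong₂ _++_ (crossingVars-off i j a (ℕP.>⇒≢ (ℕP.<-trans (ℕP.n<1+n a) 1+a<i)) (ℕP.>⇒≢ 1+a<i))
             (crossingVars-above j a (suc i) k (ℕP.m<n⇒m<1+n 1+a<i))

filter-atCrossing : ∀ n j a as → 1 ≤ a → suc a ≤ n →
  filter (atCrossing? j) (zGFrom n j (a ∷ as)) ≡ crossingBlock a j
filter-atCrossing n j (suc a′) as (s≤s z≤n) 1+a≤n = begin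
  filter (atCrossing? j) (zGFrom n j (a ∷ as))
    ≡⟨ trans (filter-concatMap (atCrossing? j) _ (idWord n)) (LP.concatMap-cong perLevel (idWord n)) ⟩
  concatMap (λ h → crossingVars h (j , a)) (idWord n)
    ≡⟨ cong (concatMap (λ h → crossingVars h (j , a))) levels ⟩
  concatMap (λ h → crossingVars h (j , a)) (interval 1 a′ ++ a ∷ suc a ∷ interval (suc (suc a)) r)
    ≡⟨ LP.concatMap-++ (λ h → crossingVars h (j , a)) (interval 1 a′) _ ⟩
  concatMap (λ h → crossingVars h (j , a)) (interval 1 a′) ++ concatMap (λ h → crossingVars h (j , a)) (a ∷ suc a ∷ interval (suc (suc a)) r)
    ≡⟨ cong₂ _++_ (crossingVars-below j a 1 a′ ℕP.≤-refl) block ⟩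
  crossingBlock a j ∎
  where
  open ≡-Reasoning
  a r : ℕ
  a = suc a′
  r = n ∸ suc a
  perLevel : ∀ h → filter (atCrossing? j) (crossingVars h (j , a) ++ levelVars h (suc j) as) ≡ crossingVars h (j , a)
  perLevel h = trans (LP.filter-++ (atCrossing? j) (crossingVars h (j , a)) (levelVars h (suc j) as))
    (trans (cong₂ _++_ (LP.filter-all (atCrossing? j) (crossingVars-crossing h j a))
                       (LP.filter-none (atCrossing? j) (All.map (λ { (_ , q) e → ℕP.<-irrefl (sym e) q }) (levelVars-bounds h (suc j) as))))
           (LP.++-identityʳ _))
  levels : idWord n ≡ interval 1 a′ ++ a ∷ suc a ∷ interval (suc (suc a)) r
  levels = begin
    idWord n                         ≡⟨ idWord≡interval n ⟩
    interval 1 n                     ≡⟨ cong (interval 1) (sym (trans (ℕP.+-suc a′ (suc r)) (trans (cong suc (ℕP.+-suc a′ r)) (ℕP.m+[n∸m]≡n 1+a≤n)))) ⟩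
    interval 1 (a′ ℕ.+ (2 ℕ.+ r))    ≡⟨ interval-++ 1 a′ (2 ℕ.+ r) ⟩
    interval 1 a′ ++ a ∷ suc a ∷ interval (suc (suc a)) r ∎
  block : concatMap (λ h → crossingVars h (j , a)) (a ∷ suc a ∷ interval (suc (suc a)) r) ≡ crossingBlock a j
  block rewrite dec-true (a ℕ.≟ a) refl | dec-false (suc a ℕ.≟ a) (ℕP.>⇒≢ (ℕP.n<1+n a))
              | crossingVars-above j a (suc (suc a)) r ℕP.≤-refl = refl

-- Path words through the wiring diagram

sinkAt : ℕ → List Var × ℕ → List (List Var)
sinkAt y (p , e) = if does (e ℕ.≟ y) then p ∷ [] else []

sinkPaths : ℕ → List ℕ → ℕ → ℕ → List (List Var)
sinkPaths j as x y = concatMap (sinkAt y) (paths x j as)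

-- weight words of the path families from sources u to sinks v (letter by letter), from crossing j on
pathWords : ℕ → List ℕ → Word → Word → List (List Var)
pathWords j as [] [] = [] ∷ []
pathWords j as (x ∷ u) (y ∷ v) = concatMap (λ p → map (p ++_) (pathWords j as u v)) (sinkPaths j as x y)
pathWords j as _ _ = []

nextLevels : ℕ → ℕ → List ℕ
nextLevels a x = if onCrossing x a then a ∷ suc a ∷ [] else x ∷ []

stepVars : ℕ → ℕ → ℕ → ℕ → List Var
stepVars j a x h = if onCrossing x a then (x , j , 1) ∷ (h , j , 2) ∷ [] else []

exitLevels : ℕ → Word → List Word
exitLevels a [] = [] ∷ []
exitLevels a (x ∷ u) = concatMap (λ h → map (h ∷_) (exitLevels a u)) (nextLevels a x)

crossingWord : ℕ → ℕ → Word → Word → List Var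
crossingWord j a (x ∷ u) (h ∷ c) = stepVars j a x h ++ crossingWord j a u c
crossingWord j a _ _ = []

extendPath : ℕ → ℕ → ℕ → List Var × ℕ → List Var × ℕ
extendPath j x h (p , e) = ((x , j , 1) ∷ (h , j , 2) ∷ p , e)

concatMap-concatMap : ∀ {A B C : Set} (g : B → List C) (f : A → List B) xs →
  concatMap g (concatMap f xs) ≡ concatMap (concatMap g ∘ f) xs
concatMap-concatMap g f [] = refl
concatMap-concatMap g f (x ∷ xs) =
  trans (LP.concatMap-++ g (f x) (concatMap f xs)) (cong (concatMap g (f x) ++_) (concatMap-concatMap g f xs))

sinkPaths-step : ∀ j a as x y →
  sinkPaths j (a ∷ as) x y ≡ concatMap (λ h → map (stepVars j a x h ++_) (sinkPaths (suc j) as h y)) (nextLevels a x)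
sinkPaths-step j a as x y with onCrossing x a
... | true = trans (concatMap-concatMap (sinkAt y) (λ h → map (extendPath j x h) (paths h (suc j) as)) (a ∷ suc a ∷ []))
    (LP.concatMap-cong (λ h → trans (LP.concatMap-map (sinkAt y) _ (paths h (suc j) as))
       (sym (trans (LP.map-concatMap _ (sinkAt y) (paths h (suc j) as)) (LP.concatMap-cong (prefix h) (paths h (suc j) as)))))
       (a ∷ suc a ∷ []))
  where
  prefix : ∀ h pe → map (λ p → (x , j , 1) ∷ (h , j , 2) ∷ p) (sinkAt y pe) ≡ sinkAt y ((x , j , 1) ∷ (h , j , 2) ∷ proj₁ pe , proj₂ pe)
  prefix h (p , e) with does (e ℕ.≟ y)
  ... | true = refl
  ... | false = refl
... | false = sym (trans (LP.++-identityʳ _) (LP.map-id _))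

paths-after : ∀ h j as → All (All (λ v → j ≤ crossingOf v) ∘ proj₁) (paths h j as)
paths-after h j [] = [] ∷ []
paths-after h j (a ∷ as) with onCrossing h a
... | true = AllP.concat⁺ (AllP.map⁺ {f = λ h′ → map (extendPath j h h′) (paths h′ (suc j) as)} (from a ∷ from (suc a) ∷ []))
  where
  from : ∀ h′ → All (All (λ v → j ≤ crossingOf v) ∘ proj₁) (map (extendPath j h h′) (paths h′ (suc j) as))
  from h′ = AllP.map⁺ (All.map (λ later → ℕP.≤-refl ∷ ℕP.≤-refl ∷ All.map ℕP.<⇒≤ later) (paths-after h′ (suc j) as))
... | false = All.map (All.map ℕP.<⇒≤) (paths-after h (suc j) as)

sinkPaths-after : ∀ h j as y → All (All (λ v → j < crossingOf v)) (sinkPaths (suc j) as h y)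
sinkPaths-after h j as y =
  AllP.concat⁺ (AllP.map⁺ (All.map (λ { {p , e} later → sunk e p later }) (paths-after h (suc j) as)))
  where
  sunk : ∀ e p → All (λ v → j < crossingOf v) p → All (All (λ v → j < crossingOf v)) (sinkAt y (p , e))
  sunk e p later with does (e ℕ.≟ y)
  ... | true = later ∷ []
  ... | false = []

stepVars-atCrossing : ∀ j a x h → All (λ v → crossingOf v ≡ j) (stepVars j a x h)
stepVars-atCrossing j a x h with onCrossing x a
... | true = refl ∷ refl ∷ []
... | false = []

∑-exitLevels : ∀ {a x u} (F : Word → Laurent) →
  ∑ F (exitLevels a (x ∷ u)) ≋ ∑ (λ h → ∑ (λ c → F (h ∷ c)) (exitLevels a u)) (nextLevels a x)
∑-exitLevels {a} {x} {u} F = ≋-trans (∑-concatMap F _ (nextLevels a x))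
  (∑-cong (nextLevels a x) (λ h → ∑-map F (h ∷_) (exitLevels a u)))

module FirstCrossing (j a : ℕ) (as : List ℕ) where

  atJ afterJ : List Var → List Var
  atJ = filter (atCrossing? j)
  afterJ = filter (¬? ∘ atCrossing? j)

  atJ-step : ∀ x h r → All (λ v → j < crossingOf v) r → atJ (stepVars j a x h ++ r) ≡ stepVars j a x h
  atJ-step x h r later = trans (LP.filter-++ (atCrossing? j) (stepVars j a x h) r)
    (trans (cong₂ _++_ (LP.filter-all (atCrossing? j) (stepVars-atCrossing j a x h))
                       (LP.filter-none (atCrossing? j) (All.map ℕP.>⇒≢ later)))
           (LP.++-identityʳ _))

  afterJ-step : ∀ x h r → All (λ v → j < crossingOf v) r → afterJ (stepVars j a x h ++ r) ≡ r
  afterJ-step x h r later = trans (LP.filter-++ (¬? ∘ atCrossing? j) (stepVars j a x h) r)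
    (cong₂ _++_ (LP.filter-none (¬? ∘ atCrossing? j) (All.map (λ e ne → ne e) (stepVars-atCrossing j a x h)))
                (LP.filter-all (¬? ∘ atCrossing? j) (All.map ℕP.>⇒≢ later)))

  ∑-sinkPaths : ∀ x y (K : List Var → List Var → Laurent) →
    ∑ (λ p → K (atJ p) (afterJ p)) (sinkPaths j (a ∷ as) x y)
    ≋ ∑ (λ h → ∑ (K (stepVars j a x h)) (sinkPaths (suc j) as h y)) (nextLevels a x)
  ∑-sinkPaths x y K = begin
    ∑ (λ p → K (atJ p) (afterJ p)) (sinkPaths j (a ∷ as) x y)
      ≡⟨ cong (∑ (λ p → K (atJ p) (afterJ p))) (sinkPaths-step j a as x y) ⟩
    ∑ (λ p → K (atJ p) (afterJ p)) (concatMap (λ h → map (stepVars j a x h ++_) (sinkPaths (suc j) as h y)) (nextLevels a x))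
      ≈⟨ ∑-concatMap _ _ (nextLevels a x) ⟩
    ∑ (λ h → ∑ (λ p → K (atJ p) (afterJ p)) (map (stepVars j a x h ++_) (sinkPaths (suc j) as h y))) (nextLevels a x)
      ≈⟨ ∑-cong (nextLevels a x) (λ h → ≋-trans (∑-map _ _ (sinkPaths (suc j) as h y))
           (∑-congᴬ (All.map (λ {r} later → ≡⇒≋ (cong₂ K (atJ-step x h r later) (afterJ-step x h r later)))
                             (sinkPaths-after h j as y)))) ⟩
    ∑ (λ h → ∑ (K (stepVars j a x h)) (sinkPaths (suc j) as h y)) (nextLevels a x) ∎
    where open ≋-Reasoning

  -- the paths of a family cross crossing j independently of each other
  ∑-pathWords : ∀ (F : List Var → List Var → Laurent) u v → length u ≡ length v →
    ∑ (λ w → F (atJ w) (afterJ w)) (pathWords j (a ∷ as) u v)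
    ≋ ∑ (λ c → ∑ (F (crossingWord j a u c)) (pathWords (suc j) as c v)) (exitLevels a u)
  ∑-pathWords F [] [] _ = ≋-sym (+L-identityʳ _)
  ∑-pathWords F (x ∷ u) (y ∷ v) ∣u∣≡∣v∣ = begin
    ∑ G (concatMap (λ p → map (p ++_) W) (sinkPaths j (a ∷ as) x y))
      ≈⟨ ∑-concatMap G _ (sinkPaths j (a ∷ as) x y) ⟩
    ∑ (λ p → ∑ G (map (p ++_) W)) (sinkPaths j (a ∷ as) x y)
      ≈⟨ ∑-cong (sinkPaths j (a ∷ as) x y) (λ p → ≋-trans (∑-map G (p ++_) W)
           (≋-trans (∑-cong W (λ w → ≡⇒≋ (cong₂ F (LP.filter-++ (atCrossing? j) p w) (LP.filter-++ (¬? ∘ atCrossing? j) p w))))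
                    (∑-pathWords (λ P R → F (atJ p ++ P) (afterJ p ++ R)) u v (ℕP.suc-injective ∣u∣≡∣v∣)))) ⟩
    ∑ (λ p → Inner (atJ p) (afterJ p)) (sinkPaths j (a ∷ as) x y)
      ≈⟨ ∑-sinkPaths x y Inner ⟩
    ∑ (λ h → ∑ (Inner (stepVars j a x h)) (SP h)) (nextLevels a x)
      ≈⟨ ∑-cong (nextLevels a x) (λ h → ∑-comm _ (SP h) (exitLevels a u)) ⟩
    ∑ (λ h → ∑ (λ c → ∑ (λ r₁ → ∑ (λ r → F (stepVars j a x h ++ crossingWord j a u c) (r₁ ++ r)) (V c)) (SP h)) (exitLevels a u)) (nextLevels a x)
      ≈⟨ ∑-cong (nextLevels a x) (λ h → ∑-cong (exitLevels a u) (λ c → ≋-sym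
           (≋-trans (∑-concatMap _ _ (SP h)) (∑-cong (SP h) (λ r₁ → ∑-map _ (r₁ ++_) (V c)))))) ⟩
    ∑ (λ h → ∑ (λ c → ∑ (F (crossingWord j a (x ∷ u) (h ∷ c))) (pathWords (suc j) as (h ∷ c) (y ∷ v))) (exitLevels a u)) (nextLevels a x)
      ≈⟨ ≋-sym (∑-exitLevels {a} {x} {u} (λ c → ∑ (F (crossingWord j a (x ∷ u) c)) (pathWords (suc j) as c (y ∷ v)))) ⟩
    ∑ (λ c → ∑ (F (crossingWord j a (x ∷ u) c)) (pathWords (suc j) as c (y ∷ v))) (exitLevels a (x ∷ u)) ∎
    where
    open ≋-Reasoning
    G : List Var → Laurent
    G w = F (atJ w) (afterJ w)
    W : List (List Var)
    W = pathWords j (a ∷ as) u v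
    SP : ℕ → List (List Var)
    SP h = sinkPaths (suc j) as h y
    V : Word → List (List Var)
    V c = pathWords (suc j) as c v
    Inner : List Var → List Var → Laurent
    Inner P R = ∑ (λ c → ∑ (λ r → F (P ++ crossingWord j a u c) (R ++ r)) (V c)) (exitLevels a u)

-- Permutations

IsPerm : ℕ → Word → Set
IsPerm n u = u ↭ idWord n

Unique-resp-↭ : ∀ {A : Set} {xs ys : List A} → xs ↭ ys → Unique xs → Unique ys
Unique-resp-↭ {A} p = ↭ₛP.Unique-resp-↭ (setoid A) (↭⇒↭ₛ p)

idWord-unique : ∀ n → Unique (idWord n)
idWord-unique n = UniqueP.map⁺ ℕP.suc-injective (UniqueP.upTo⁺ n)

∈-idWord : ∀ n x → 1 ≤ x → x ≤ n → x ∈ idWord n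
∈-idWord n (suc x) (s≤s z≤n) x<n = ∈-map⁺ suc (∈-upTo⁺ x<n)

idWord-bounded : ∀ n → All (_≤ n) (idWord n)
idWord-bounded n = All.tabulate λ x∈ → case (∈-map⁻ suc x∈)
  where
  case : ∀ {x} → Σ[ i ∈ ℕ ] i ∈ upTo n × x ≡ suc i → x ≤ n
  case (i , i∈ , refl) = ∈-upTo⁻ i∈

idWord-suc : ∀ n → idWord (suc n) ≡ idWord n ++ [ suc n ]
idWord-suc n = trans (cong (map suc) (sym (LP.applyUpTo-∷ʳ id n))) (LP.map-++ suc (upTo n) [ n ])

IsPerm-unique : ∀ {n u} → IsPerm n u → Unique u
IsPerm-unique {n} p = Unique-resp-↭ (↭-sym p) (idWord-unique n)

IsPerm-∈ : ∀ {n u} x → IsPerm n u → 1 ≤ x → x ≤ n → x ∈ u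
IsPerm-∈ {n} x p 1≤x x≤n = ∈-resp-↭ (↭-sym p) (∈-idWord n x 1≤x x≤n)

IsPerm-length : ∀ {n u} → IsPerm n u → length u ≡ n
IsPerm-length {n} p = trans (↭-length p) (trans (LP.length-map suc (upTo n)) (LP.length-applyUpTo id n))

∈-insertions⇒↭ : ∀ x w {y} → y ∈ insertions x w → y ↭ x ∷ w
∈-insertions⇒↭ x [] (here refl) = ↭-refl
∈-insertions⇒↭ x (z ∷ zs) (here refl) = ↭-refl
∈-insertions⇒↭ x (z ∷ zs) (there y∈) with ∈-map⁻ (z ∷_) y∈
... | y′ , y′∈ , refl = ↭-trans (prep z (∈-insertions⇒↭ x zs y′∈)) (swap z x ↭-refl)

∈-insertions : ∀ x u₁ u₂ → u₁ ++ x ∷ u₂ ∈ insertions x (u₁ ++ u₂)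
∈-insertions x [] [] = here refl
∈-insertions x [] (z ∷ u₂) = here refl
∈-insertions x (y ∷ u₁) u₂ = there (∈-map⁺ (y ∷_) (∈-insertions x u₁ u₂))

removeFirst : ℕ → Word → Word
removeFirst x [] = []
removeFirst x (z ∷ zs) = if does (z ℕ.≟ x) then zs else z ∷ removeFirst x zs

removeFirst-insertions : ∀ x w {y} → x ∉ w → y ∈ insertions x w → removeFirst x y ≡ w
removeFirst-insertions x [] _ (here refl) rewrite dec-true (x ℕ.≟ x) refl = refl
removeFirst-insertions x (z ∷ zs) _ (here refl) rewrite dec-true (x ℕ.≟ x) refl = refl
removeFirst-insertions x (z ∷ zs) x∉ (there y∈) with ∈-map⁻ (z ∷_) y∈
... | y′ , y′∈ , refl rewrite dec-false (z ℕ.≟ x) (λ e → x∉ (here (sym e))) =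
  cong (z ∷_) (removeFirst-insertions x zs (x∉ ∘ there) y′∈)

insertions-unique : ∀ x w → x ∉ w → Unique (insertions x w)
insertions-unique x [] _ = [] ∷ []
insertions-unique x (z ∷ zs) x∉ =
  All.tabulate head≢ ∷ UniqueP.map⁺ (proj₂ ∘ LP.∷-injective) (insertions-unique x zs (x∉ ∘ there))
  where
  head≢ : ∀ {y} → y ∈ map (z ∷_) (insertions x zs) → x ∷ z ∷ zs ≢ y
  head≢ y∈ e with ∈-map⁻ (z ∷_) y∈
  ... | _ , _ , refl = x∉ (here (proj₁ (LP.∷-injective e)))

perms-sound : ∀ n {v} → v ∈ perms n → IsPerm n v
perms-sound zero (here refl) = ↭-refl
perms-sound (suc n) v∈ with find (∈-concatMap⁻ (insertions (suc n)) {xs = perms n} v∈)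
... | w , w∈ , v∈ins = ↭-trans (∈-insertions⇒↭ (suc n) w v∈ins) (↭-trans (prep (suc n) (perms-sound n w∈))
    (↭-trans (∷↭∷ʳ (suc n) (idWord n)) (↭-reflexive (sym (idWord-suc n)))))

perms-complete : ∀ n {v} → IsPerm n v → v ∈ perms n
perms-complete zero p rewrite ↭-empty-inv p = here refl
perms-complete (suc n) p with ∈-∃++ (IsPerm-∈ (suc n) p (s≤s z≤n) ℕP.≤-refl)
... | v₁ , v₂ , refl = ∈-concatMap⁺ (insertions (suc n)) (lose (perms-complete n p′) (∈-insertions (suc n) v₁ v₂))
  where
  p′ : IsPerm n (v₁ ++ v₂)
  p′ = subst (v₁ ++ v₂ ↭_) (LP.++-identityʳ (idWord n))
             (drop-mid v₁ (idWord n) (↭-trans p (↭-reflexive (idWord-suc n))))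

perms-unique : ∀ n → Unique (perms n)
perms-unique zero = [] ∷ []
perms-unique (suc n) = go (perms n) (perms-unique n) (λ w∈ → new∉ (perms-sound n w∈))
  where
  new∉ : ∀ {w} → IsPerm n w → suc n ∉ w
  new∉ p n+1∈w = ℕP.<-irrefl refl (All.lookup (All-resp-↭ (↭-sym p) (idWord-bounded n)) n+1∈w)
  go : ∀ ws → Unique ws → (∀ {w} → w ∈ ws → suc n ∉ w) → Unique (concatMap (insertions (suc n)) ws)
  go [] _ _ = []
  go (w ∷ ws) (w∉ws ∷ u) fresh = UniqueP.++⁺ (insertions-unique (suc n) w (fresh (here refl))) (go ws u (fresh ∘ there)) disjoint
    where
    disjoint : ∀ {y} → y ∈ insertions (suc n) w × y ∈ concatMap (insertions (suc n)) ws → ⊥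
    disjoint (y∈ , y∈′) with find (∈-concatMap⁻ (insertions (suc n)) {xs = ws} y∈′)
    ... | w′ , w′∈ , y∈ins = All.lookup w∉ws w′∈
      (trans (sym (removeFirst-insertions (suc n) w (fresh (here refl)) y∈))
             (removeFirst-insertions (suc n) w′ (fresh (there w′∈)) y∈ins))

_≟W_ : (u v : Word) → Dec (u ≡ v)
_≟W_ = LP.≡-dec ℕ._≟_

kronecker : Word → Word → Laurent
kronecker u v = if does (u ≟W v) then 1L else 0L

∑-kronecker : ∀ (F : Word → Laurent) {u} vs → Unique vs → u ∈ vs → ∑ (λ v → F v *L kronecker u v) vs ≋ F u
∑-kronecker F {u} (v ∷ vs) (v∉vs ∷ _) (here refl) rewrite dec-true (u ≟W u) refl =
  ≋-trans (+L-cong (*L-identityʳ (F u)) (∑-zero vs (All.map (λ {w} → vanish w) v∉vs)))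
          (+L-identityʳ (F u))
  where
  vanish : ∀ w → u ≢ w → F w *L kronecker u w ≋ 0L
  vanish w u≢w rewrite dec-false (u ≟W w) u≢w = *L-zeroʳ (F w)
∑-kronecker F {u} (v ∷ vs) (v∉vs ∷ uniq) (there u∈) rewrite dec-false (u ≟W v) (λ { refl → All.lookup v∉vs u∈ refl }) =
  ≋-trans (+L-cong (*L-zeroʳ (F v)) (∑-kronecker F vs uniq u∈)) ≋-refl


n≢1+n : ∀ n → n ≢ suc n
n≢1+n n = ℕP.<⇒≢ (ℕP.n<1+n n)

OffCrossing : ℕ → ℕ → Set
OffCrossing a x = onCrossing x a ≡ false

onCrossing-self : ∀ a → onCrossing a a ≡ true
onCrossing-self a rewrite dec-true (a ℕ.≟ a) refl = refl

onCrossing-suc : ∀ a → onCrossing (suc a) a ≡ true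
onCrossing-suc a rewrite dec-false (suc a ℕ.≟ a) (n≢1+n a ∘ sym) | dec-true (suc a ℕ.≟ suc a) refl = refl

onCrossing-cases : ∀ x a → onCrossing x a ≡ true → x ≡ a ⊎ x ≡ suc a
onCrossing-cases x a p with ∨-true {does (x ℕ.≟ a)} p
... | inj₁ q = inj₁ (does-true (x ℕ.≟ a) q)
... | inj₂ q = inj₂ (does-true (x ℕ.≟ suc a) q)

OffCrossing-≢ : ∀ {a x} → OffCrossing a x → x ≢ a × x ≢ suc a
OffCrossing-≢ {a} {x} off = (λ { refl → clash (onCrossing-self a) }) , (λ { refl → clash (onCrossing-suc a) })
  where
  clash : onCrossing x a ≡ true → ⊥
  clash on with trans (sym on) off
  ... | ()

swapLetter-self : ∀ a → swapLetter a a ≡ suc a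
swapLetter-self a rewrite dec-true (a ℕ.≟ a) refl = refl

swapLetter-suc : ∀ a → swapLetter a (suc a) ≡ a
swapLetter-suc a rewrite dec-false (suc a ℕ.≟ a) (n≢1+n a ∘ sym) | dec-true (suc a ℕ.≟ suc a) refl = refl

swapLetter-off : ∀ {a z} → OffCrossing a z → swapLetter a z ≡ z
swapLetter-off {a} {z} off rewrite dec-false (z ℕ.≟ a) (proj₁ (OffCrossing-≢ off)) | dec-false (z ℕ.≟ suc a) (proj₂ (OffCrossing-≢ off)) = refl

swapAt-off : ∀ {a} w → All (OffCrossing a) w → swapAt a w ≡ w
swapAt-off [] [] = refl
swapAt-off (z ∷ w) (off ∷ offs) = cong₂ _∷_ (swapLetter-off off) (swapAt-off w offs)

ascentAt-off : ∀ {a} w T → All (OffCrossing a) w → ascentAt a (w ++ T) ≡ ascentAt a T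
ascentAt-off [] T [] = refl
ascentAt-off {a} (z ∷ w) T (off ∷ offs)
  rewrite dec-false (z ℕ.≟ a) (proj₁ (OffCrossing-≢ off)) | dec-false (z ℕ.≟ suc a) (proj₂ (OffCrossing-≢ off)) =
  ascentAt-off w T offs

splitAtFirst : ∀ {A : Set} (p : A → Bool) u → Any (λ x → p x ≡ true) u →
  Σ[ u₁ ∈ List A ] Σ[ x ∈ A ] Σ[ rest ∈ List A ] u ≡ u₁ ++ x ∷ rest × All (λ y → p y ≡ false) u₁ × p x ≡ true
splitAtFirst p (y ∷ u) any with p y in py
... | true = [] , y , u , refl , [] , py
... | false with any
... | here py≡true with () ← trans (sym py) py≡true
... | there any′ with splitAtFirst p u any′
... | u₁ , x , rest , refl , offs , px = y ∷ u₁ , x , rest , refl , py ∷ offs , px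

CrossingPair : ℕ → ℕ → ℕ → Set
CrossingPair a x₁ x₂ = (x₁ ≡ a × x₂ ≡ suc a) ⊎ (x₁ ≡ suc a × x₂ ≡ a)

crossingPair : ∀ {a x} → onCrossing x a ≡ true → CrossingPair a x (swapLetter a x)
crossingPair {a} {x} on with onCrossing-cases x a on
... | inj₁ refl = inj₁ (refl , swapLetter-self a)
... | inj₂ refl = inj₂ (refl , swapLetter-suc a)

CrossingPair-≢ : ∀ {a x₁ x₂} → CrossingPair a x₁ x₂ → x₂ ≢ x₁
CrossingPair-≢ {a} (inj₁ (refl , refl)) = n≢1+n a ∘ sym
CrossingPair-≢ {a} (inj₂ (refl , refl)) = n≢1+n a

CrossingPair-on : ∀ {a x₁ x₂} → CrossingPair a x₁ x₂ → onCrossing x₂ a ≡ true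
CrossingPair-on {a} (inj₁ (_ , refl)) = onCrossing-suc a
CrossingPair-on {a} (inj₂ (_ , refl)) = onCrossing-self a

CrossingPair-only : ∀ {a x₁ x₂} → CrossingPair a x₁ x₂ → ∀ {z} → onCrossing z a ≡ true → z ≢ x₁ → z ≡ x₂
CrossingPair-only {a} pair {z} on z≢x₁ with pair | onCrossing-cases z a on
... | inj₁ (refl , refl) | inj₁ refl = ⊥-elim (z≢x₁ refl)
... | inj₁ (refl , refl) | inj₂ refl = refl
... | inj₂ (refl , refl) | inj₁ refl = refl
... | inj₂ (refl , refl) | inj₂ refl = ⊥-elim (z≢x₁ refl)

CrossingPair-bounds : ∀ {n a x₁ x₂} → CrossingPair a x₁ x₂ → 1 ≤ a → suc a ≤ n → 1 ≤ x₂ × x₂ ≤ n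
CrossingPair-bounds (inj₁ (_ , refl)) 1≤a 1+a≤n = s≤s z≤n , 1+a≤n
CrossingPair-bounds (inj₂ (_ , refl)) 1≤a 1+a≤n = 1≤a , ℕP.<⇒≤ 1+a≤n

record CrossingLetters (a : ℕ) (u : Word) : Set where
  constructor crossingLetters
  field
    u₁ u₂ u₃ : Word
    x₁ x₂ : ℕ
    split : u ≡ u₁ ++ x₁ ∷ u₂ ++ x₂ ∷ u₃
    off₁ : All (OffCrossing a) u₁
    off₂ : All (OffCrossing a) u₂
    off₃ : All (OffCrossing a) u₃
    order : CrossingPair a x₁ x₂

Unique-∷⇒∉ : ∀ {A : Set} {x : A} {xs} → Unique (x ∷ xs) → x ∉ xs
Unique-∷⇒∉ (x∉ ∷ _) x∈ = All.lookup x∉ x∈ refl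

Unique-++⁻ʳ : ∀ {A : Set} (xs : List A) {ys} → Unique (xs ++ ys) → Unique ys
Unique-++⁻ʳ [] u = u
Unique-++⁻ʳ (x ∷ xs) (_ ∷ u) = Unique-++⁻ʳ xs u

∈-after : ∀ {A : Set} {p : A → Bool} {x y} u₁ rest → All (λ z → p z ≡ false) u₁ → p y ≡ true → y ≢ x →
  y ∈ u₁ ++ x ∷ rest → y ∈ rest
∈-after u₁ rest off on y≢x y∈ with ∈-++⁻ u₁ y∈
... | inj₁ y∈u₁ with () ← trans (sym (All.lookup off y∈u₁)) on
... | inj₂ (here y≡x) = ⊥-elim (y≢x y≡x)
... | inj₂ (there y∈rest) = y∈rest

findCrossingLetters : ∀ {n u a} → IsPerm n u → 1 ≤ a → suc a ≤ n → CrossingLetters a u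
findCrossingLetters {n} {u} {a} p 1≤a 1+a≤n
  with splitAtFirst (λ x → onCrossing x a) u (Any.map (λ { refl → onCrossing-self a }) (IsPerm-∈ a p 1≤a (ℕP.<⇒≤ 1+a≤n)))
... | u₁ , x₁ , rest , refl , off₁ , on₁ = withPartner (crossingPair on₁)
  where
  x₁∉rest : x₁ ∉ rest
  x₁∉rest = Unique-∷⇒∉ (Unique-++⁻ʳ u₁ (IsPerm-unique p))
  withPartner : ∀ {x₂} → CrossingPair a x₁ x₂ → CrossingLetters a (u₁ ++ x₁ ∷ rest)
  withPartner {x₂} pair with splitAtFirst (λ x → onCrossing x a) rest (Any.map (λ { refl → CrossingPair-on pair })
    (∈-after u₁ rest off₁ (CrossingPair-on pair) (CrossingPair-≢ pair) (uncurry (IsPerm-∈ x₂ p) (CrossingPair-bounds pair 1≤a 1+a≤n))))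
  ... | u₂ , y , u₃ , refl , off₂ , on-y with CrossingPair-only pair {y} on-y (λ { refl → x₁∉rest (∈-++⁺ʳ u₂ (here refl)) })
  ... | refl = crossingLetters u₁ u₂ u₃ x₁ x₂ refl off₁ off₂ (All.tabulate (≢true⇒≡false ∘ off₃)) pair
    where
    x₂∉u₃ : x₂ ∉ u₃
    x₂∉u₃ = Unique-∷⇒∉ (Unique-++⁻ʳ u₂ (Unique-++⁻ʳ [ x₁ ] (Unique-++⁻ʳ u₁ (IsPerm-unique p))))
    off₃ : ∀ {z} → z ∈ u₃ → onCrossing z a ≢ true
    off₃ {z} z∈ on-z with z ℕ.≟ x₁
    ... | yes refl = x₁∉rest (∈-++⁺ʳ u₂ (there z∈))
    ... | no z≢x₁ with CrossingPair-only pair on-z z≢x₁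
    ... | refl = x₂∉u₃ z∈

∑-exitLevels-off : ∀ a (F : Word → Laurent) w T → All (OffCrossing a) w →
  ∑ F (exitLevels a (w ++ T)) ≋ ∑ (F ∘ (w ++_)) (exitLevels a T)
∑-exitLevels-off a F [] T [] = ≋-refl
∑-exitLevels-off a F (z ∷ w) T (off ∷ offs) = begin
  ∑ F (exitLevels a (z ∷ w ++ T))
    ≈⟨ ∑-exitLevels {a} {z} {w ++ T} F ⟩
  ∑ (λ h → ∑ (F ∘ (h ∷_)) (exitLevels a (w ++ T))) (nextLevels a z)
    ≡⟨ cong (λ b → ∑ (λ h → ∑ (F ∘ (h ∷_)) (exitLevels a (w ++ T))) (if b then a ∷ suc a ∷ [] else z ∷ [])) off ⟩
  ∑ (F ∘ (z ∷_)) (exitLevels a (w ++ T)) +L 0L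
    ≈⟨ ≋-trans (+L-identityʳ _) (∑-exitLevels-off a (F ∘ (z ∷_)) w T offs) ⟩
  ∑ (F ∘ ((z ∷ w) ++_)) (exitLevels a T) ∎
  where open ≋-Reasoning

∑-exitLevels-on : ∀ a (F : Word → Laurent) x T → onCrossing x a ≡ true →
  ∑ F (exitLevels a (x ∷ T)) ≋ ∑ (λ h → ∑ (F ∘ (h ∷_)) (exitLevels a T)) (a ∷ suc a ∷ [])
∑-exitLevels-on a F x T on = ≋-trans (∑-exitLevels {a} {x} {T} F)
  (≡⇒≋ (cong (λ b → ∑ (λ h → ∑ (F ∘ (h ∷_)) (exitLevels a T)) (if b then a ∷ suc a ∷ [] else x ∷ [])) on))

exitLevels-off : ∀ a w → All (OffCrossing a) w → exitLevels a w ≡ w ∷ []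
exitLevels-off a [] [] = refl
exitLevels-off a (z ∷ w) (off ∷ offs) rewrite off | exitLevels-off a w offs = refl

crossingWord-off : ∀ j a w T c → All (OffCrossing a) w → crossingWord j a (w ++ T) (w ++ c) ≡ crossingWord j a T c
crossingWord-off j a [] T c [] = refl
crossingWord-off j a (z ∷ w) T c (off ∷ offs) rewrite off = crossingWord-off j a w T c offs

crossingWord-off-self : ∀ j a w → All (OffCrossing a) w → crossingWord j a w w ≡ []
crossingWord-off-self j a [] [] = refl
crossingWord-off-self j a (z ∷ w) (off ∷ offs) rewrite off = crossingWord-off-self j a w offs

crossingWord-on : ∀ j a x h T c → onCrossing x a ≡ true →
  crossingWord j a (x ∷ T) (h ∷ c) ≡ (x , j , 1) ∷ (h , j , 2) ∷ crossingWord j a T c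
crossingWord-on j a x h T c on rewrite on = refl

exchange : ∀ (x y : ℕ) (p q : Word) → x ∷ p ++ y ∷ q ↭ y ∷ p ++ x ∷ q
exchange x y p q = ↭-trans (prep x (shift y p q)) (↭-trans (swap x y ↭-refl) (prep y (↭-sym (shift x p q))))

bit : Bool → ℕ
bit b = if b then 1 else 0

smaller : ℕ → Word → ℕ
smaller c ys = length (filter (ℕ._<? c) ys)

smaller-∷ : ∀ c z ys → smaller c (z ∷ ys) ≡ bit (does (z ℕ.<? c)) ℕ.+ smaller c ys
smaller-∷ c z ys with does (z ℕ.<? c)
... | true = refl
... | false = refl

smaller-++ : ∀ c xs ys → smaller c (xs ++ ys) ≡ smaller c xs ℕ.+ smaller c ys
smaller-++ c xs ys = trans (cong length (LP.filter-++ (ℕ._<? c) xs ys)) (LP.length-++ (filter (ℕ._<? c) xs))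

smaller-↭ : ∀ c {xs ys} → xs ↭ ys → smaller c xs ≡ smaller c ys
smaller-↭ c p = ↭-length (filter-↭ (ℕ._<? c) p)

-- len (y ∷ w) = smaller y w + len w, so a common prefix contributes equally
len-prefix : ∀ w T T′ → All (λ y → smaller y T′ ≡ smaller y T) w → len (w ++ T′) ℕ.+ len T ≡ len (w ++ T) ℕ.+ len T′
len-prefix [] T T′ [] = ℕP.+-comm (len T′) (len T)
len-prefix (y ∷ w) T T′ (same ∷ sames) = begin
  smaller y (w ++ T′) ℕ.+ len (w ++ T′) ℕ.+ len T
    ≡⟨ cong (λ t → t ℕ.+ len (w ++ T′) ℕ.+ len T)
            (trans (smaller-++ y w T′) (trans (cong (smaller y w ℕ.+_) same) (sym (smaller-++ y w T)))) ⟩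
  smaller y (w ++ T) ℕ.+ len (w ++ T′) ℕ.+ len T
    ≡⟨ ℕP.+-assoc (smaller y (w ++ T)) _ _ ⟩
  smaller y (w ++ T) ℕ.+ (len (w ++ T′) ℕ.+ len T)
    ≡⟨ cong (smaller y (w ++ T) ℕ.+_) (len-prefix w T T′ sames) ⟩
  smaller y (w ++ T) ℕ.+ (len (w ++ T) ℕ.+ len T′)
    ≡⟨ sym (ℕP.+-assoc (smaller y (w ++ T)) _ _) ⟩
  smaller y (w ++ T) ℕ.+ len (w ++ T) ℕ.+ len T′ ∎
  where open ≡-Reasoning

does-⇔ : ∀ {P Q : Set} (p : Dec P) (q : Dec Q) → (P → Q) → (Q → P) → does p ≡ does q
does-⇔ (yes p) (yes q) f g = refl
does-⇔ (no ¬p) (no ¬q) f g = refl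
does-⇔ (yes p) (no ¬q) f g = ⊥-elim (¬q (f p))
does-⇔ (no ¬p) (yes q) f g = ⊥-elim (¬p (g q))

<a⇔<1+a : ∀ a z → z ≢ a → does (z ℕ.<? a) ≡ does (z ℕ.<? suc a)
<a⇔<1+a a z z≢a = does-⇔ (z ℕ.<? a) (z ℕ.<? suc a) ℕP.m<n⇒m<1+n (λ z<1+a → ℕP.≤∧≢⇒< (ℕP.m<1+n⇒m≤n z<1+a) z≢a)

a<⇔1+a< : ∀ a y → y ≢ suc a → does (a ℕ.<? y) ≡ does (suc a ℕ.<? y)
a<⇔1+a< a y y≢1+a = does-⇔ (a ℕ.<? y) (suc a ℕ.<? y) (λ a<y → ℕP.≤∧≢⇒< a<y (y≢1+a ∘ sym)) ℕP.<⇒≤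

smaller-off : ∀ a ys → All (OffCrossing a) ys → smaller a ys ≡ smaller (suc a) ys
smaller-off a [] [] = refl
smaller-off a (z ∷ ys) (off ∷ offs) = begin
  smaller a (z ∷ ys)                              ≡⟨ smaller-∷ a z ys ⟩
  bit (does (z ℕ.<? a)) ℕ.+ smaller a ys          ≡⟨ cong₂ ℕ._+_ (cong bit (<a⇔<1+a a z (proj₁ (OffCrossing-≢ off)))) (smaller-off a ys offs) ⟩
  bit (does (z ℕ.<? suc a)) ℕ.+ smaller (suc a) ys ≡⟨ sym (smaller-∷ (suc a) z ys) ⟩
  smaller (suc a) (z ∷ ys) ∎
  where open ≡-Reasoning

module CrossingLettersProperties {a : ℕ} {u : Word} (d : CrossingLetters a u) where
  open CrossingLetters d

  onCrossing-x₁ : onCrossing x₁ a ≡ true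
  onCrossing-x₁ with order
  ... | inj₁ (refl , _) = onCrossing-self a
  ... | inj₂ (refl , _) = onCrossing-suc a

  onCrossing-x₂ : onCrossing x₂ a ≡ true
  onCrossing-x₂ = CrossingPair-on order

  swapLetter-x₁ : swapLetter a x₁ ≡ x₂
  swapLetter-x₁ with order
  ... | inj₁ (refl , refl) = swapLetter-self a
  ... | inj₂ (refl , refl) = swapLetter-suc a

  swapLetter-x₂ : swapLetter a x₂ ≡ x₁
  swapLetter-x₂ with order
  ... | inj₁ (refl , refl) = swapLetter-suc a
  ... | inj₂ (refl , refl) = swapLetter-self a

  swapAt-split : swapAt a u ≡ u₁ ++ x₂ ∷ u₂ ++ x₁ ∷ u₃
  swapAt-split rewrite split = trans (LP.map-++ (swapLetter a) u₁ (x₁ ∷ u₂ ++ x₂ ∷ u₃))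
    (cong₂ _++_ (swapAt-off u₁ off₁) (cong₂ _∷_ swapLetter-x₁ (trans (LP.map-++ (swapLetter a) u₂ (x₂ ∷ u₃))
      (cong₂ _++_ (swapAt-off u₂ off₂) (cong₂ _∷_ swapLetter-x₂ (swapAt-off u₃ off₃))))))

  swapAt-↭ : swapAt a u ↭ u
  swapAt-↭ rewrite swapAt-split | split = ++⁺ˡ u₁ (exchange x₂ x₁ u₂ u₃)

  ascentAt-up : x₁ ≡ a → ascentAt a u ≡ true
  ascentAt-up refl rewrite split | ascentAt-off u₁ (x₁ ∷ u₂ ++ x₂ ∷ u₃) off₁ | dec-true (x₁ ℕ.≟ x₁) refl = refl

  ascentAt-down : x₁ ≡ suc a → ascentAt a u ≡ false
  ascentAt-down refl rewrite split | ascentAt-off u₁ (x₁ ∷ u₂ ++ x₂ ∷ u₃) off₁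
    | dec-false (suc a ℕ.≟ a) (n≢1+n a ∘ sym) | dec-true (suc a ℕ.≟ suc a) refl = refl

  ∑-exitLevels-split : ∀ (F : Word → Laurent) →
    ∑ F (exitLevels a u) ≋ ∑ (λ h₁ → ∑ (λ h₂ → F (u₁ ++ h₁ ∷ u₂ ++ h₂ ∷ u₃)) (a ∷ suc a ∷ [])) (a ∷ suc a ∷ [])
  ∑-exitLevels-split F rewrite split =
    ≋-trans (∑-exitLevels-off a F u₁ (x₁ ∷ u₂ ++ x₂ ∷ u₃) off₁)
    (≋-trans (∑-exitLevels-on a (F ∘ (u₁ ++_)) x₁ (u₂ ++ x₂ ∷ u₃) onCrossing-x₁)
    (∑-cong (a ∷ suc a ∷ []) λ h₁ →
      ≋-trans (∑-exitLevels-off a (λ c → F (u₁ ++ h₁ ∷ c)) u₂ (x₂ ∷ u₃) off₂)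
      (≋-trans (∑-exitLevels-on a (λ c → F (u₁ ++ h₁ ∷ u₂ ++ c)) x₂ u₃ onCrossing-x₂)
      (∑-cong (a ∷ suc a ∷ []) λ h₂ →
        ≋-trans (≡⇒≋ (cong (∑ (λ c → F (u₁ ++ h₁ ∷ u₂ ++ h₂ ∷ c))) (exitLevels-off a u₃ off₃)))
                (+L-identityʳ _)))))

  crossingWord-split : ∀ j h₁ h₂ →
    crossingWord j a u (u₁ ++ h₁ ∷ u₂ ++ h₂ ∷ u₃) ≡ (x₁ , j , 1) ∷ (h₁ , j , 2) ∷ (x₂ , j , 1) ∷ (h₂ , j , 2) ∷ []
  crossingWord-split j h₁ h₂ rewrite split =
    trans (crossingWord-off j a u₁ (x₁ ∷ u₂ ++ x₂ ∷ u₃) (h₁ ∷ u₂ ++ h₂ ∷ u₃) off₁)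
    (trans (crossingWord-on j a x₁ h₁ (u₂ ++ x₂ ∷ u₃) (u₂ ++ h₂ ∷ u₃) onCrossing-x₁)
    (cong ((x₁ , j , 1) ∷_) (cong ((h₁ , j , 2) ∷_)
      (trans (crossingWord-off j a u₂ (x₂ ∷ u₃) (h₂ ∷ u₃) off₂)
      (trans (crossingWord-on j a x₂ h₂ u₃ u₃ onCrossing-x₂)
      (cong (λ r → (x₂ , j , 1) ∷ (h₂ , j , 2) ∷ r) (crossingWord-off-self j a u₃ off₃)))))))

  -- the only inversion that changes is the pair x₁ x₂ itself
  T T′ : Word
  T = x₁ ∷ u₂ ++ x₂ ∷ u₃
  T′ = x₂ ∷ u₂ ++ x₁ ∷ u₃

  len-swapAt-tail : len (swapAt a u) ℕ.+ len T ≡ len u ℕ.+ len T′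
  len-swapAt-tail rewrite swapAt-split | split =
    len-prefix u₁ T T′ (All.tabulate (λ {y} _ → smaller-↭ y (exchange x₂ x₁ u₂ u₃)))

  x₁<⇔x₂< : ∀ y → OffCrossing a y → does (x₁ ℕ.<? y) ≡ does (x₂ ℕ.<? y)
  x₁<⇔x₂< y off with order
  ... | inj₁ (refl , refl) = a<⇔1+a< a y (proj₂ (OffCrossing-≢ off))
  ... | inj₂ (refl , refl) = sym (a<⇔1+a< a y (proj₂ (OffCrossing-≢ off)))

  smaller-x₁≡x₂ : ∀ ys → All (OffCrossing a) ys → smaller x₁ ys ≡ smaller x₂ ys
  smaller-x₁≡x₂ ys offs with order
  ... | inj₁ (refl , refl) = smaller-off a ys offs
  ... | inj₂ (refl , refl) = sym (smaller-off a ys offs)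

  len-middle : len (u₂ ++ x₁ ∷ u₃) ≡ len (u₂ ++ x₂ ∷ u₃)
  len-middle = ℕP.+-cancelʳ-≡ (len (x₂ ∷ u₃)) _ _ (trans
    (len-prefix u₂ (x₂ ∷ u₃) (x₁ ∷ u₃) (All.map (λ {y} off → trans (smaller-∷ y x₁ u₃)
      (trans (cong (λ t → bit t ℕ.+ smaller y u₃) (x₁<⇔x₂< y off)) (sym (smaller-∷ y x₂ u₃)))) off₂))
    (cong (λ t → len (u₂ ++ x₂ ∷ u₃) ℕ.+ (t ℕ.+ len u₃)) (smaller-x₁≡x₂ u₃ off₃)))

  len-T : len T ≡ smaller x₁ u₂ ℕ.+ (bit (does (x₂ ℕ.<? x₁)) ℕ.+ smaller x₁ u₃) ℕ.+ len (u₂ ++ x₂ ∷ u₃)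
  len-T = cong (ℕ._+ len (u₂ ++ x₂ ∷ u₃)) (trans (smaller-++ x₁ u₂ (x₂ ∷ u₃)) (cong (smaller x₁ u₂ ℕ.+_) (smaller-∷ x₁ x₂ u₃)))

  len-T′ : len T′ ≡ smaller x₁ u₂ ℕ.+ (bit (does (x₁ ℕ.<? x₂)) ℕ.+ smaller x₁ u₃) ℕ.+ len (u₂ ++ x₂ ∷ u₃)
  len-T′ = cong₂ ℕ._+_ (trans (smaller-++ x₂ u₂ (x₁ ∷ u₃)) (cong₂ ℕ._+_ (sym (smaller-x₁≡x₂ u₂ off₂))
    (trans (smaller-∷ x₂ x₁ u₃) (cong (bit (does (x₁ ℕ.<? x₂)) ℕ.+_) (sym (smaller-x₁≡x₂ u₃ off₃)))))) len-middle

  len-swapAt-up : x₁ ≡ a → len (swapAt a u) ≡ suc (len u)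
  len-swapAt-up e with order
  ... | inj₂ (e′ , _) = ⊥-elim (n≢1+n a (trans (sym e) e′))
  ... | inj₁ (refl , refl) = ℕP.+-cancelʳ-≡ (len T) _ _
      (trans len-swapAt-tail (trans (cong (len u ℕ.+_) T′≡1+T) (ℕP.+-suc (len u) (len T))))
    where
    T′≡1+T : len T′ ≡ suc (len T)
    T′≡1+T rewrite len-T | len-T′ | dec-false (suc a ℕ.<? a) (ℕP.<-asym (ℕP.n<1+n a)) | dec-true (a ℕ.<? suc a) (ℕP.n<1+n a) =
      cong (ℕ._+ len (u₂ ++ suc a ∷ u₃)) (ℕP.+-suc (smaller a u₂) (smaller a u₃))

  len-swapAt-down : x₁ ≡ suc a → suc (len (swapAt a u)) ≡ len u
  len-swapAt-down e with order
  ... | inj₁ (e′ , _) = ⊥-elim (n≢1+n a (trans (sym e′) e))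
  ... | inj₂ (refl , refl) = ℕP.+-cancelʳ-≡ (len T′) _ _
      (trans (sym (ℕP.+-suc (len (swapAt a u)) (len T′))) (trans (cong (len (swapAt a u) ℕ.+_) (sym T≡1+T′)) len-swapAt-tail))
    where
    T≡1+T′ : len T ≡ suc (len T′)
    T≡1+T′ rewrite len-T | len-T′ | dec-false (suc a ℕ.<? a) (ℕP.<-asym (ℕP.n<1+n a)) | dec-true (a ℕ.<? suc a) (ℕP.n<1+n a) =
      cong (ℕ._+ len (u₂ ++ a ∷ u₃)) (ℕP.+-suc (smaller (suc a) u₂) (smaller (suc a) u₃))

-- Summing over path families, one crossing at a time

crossingBlock-sorted : ∀ a j → AllPairs _<ᵛ_ (crossingBlock a j)
crossingBlock-sorted a j =
  (end< 1<2 ∷ level< (ℕP.n<1+n a) ∷ level< (ℕP.n<1+n a) ∷ []) ∷ (level< (ℕP.n<1+n a) ∷ level< (ℕP.n<1+n a) ∷ [])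
  ∷ (end< 1<2 ∷ []) ∷ [] ∷ []
  where
  1<2 : 1 < 2
  1<2 = s≤s (s≤s z≤n)

qPair-below : ∀ h j k → qPair (suc h , j , k) (h , j , k) ≡ true
qPair-below h j k rewrite dec-true (suc h ℕ.≟ suc h) refl | dec-true (j ℕ.≟ j) refl | dec-true (k ℕ.≟ k) refl = refl

qPair-level : ∀ {h h′} j k j′ k′ → h ≢ suc h′ → qPair (h , j , k) (h′ , j′ , k′) ≡ false
qPair-level {h} {h′} j k j′ k′ ne rewrite dec-false (h ℕ.≟ suc h′) ne = refl

qPair-ends : ∀ h j h′ {k k′} → k ≢ k′ → qPair (h , j , k) (h′ , j , k′) ≡ false
qPair-ends h j h′ {k} {k′} ne with does (h ℕ.≟ suc h′)
... | false = refl
... | true rewrite dec-true (j ℕ.≟ j) refl | dec-false (k ℕ.≟ k′) ne = refl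

1≢2 : 1 ≢ 2
1≢2 ()

qInversions₄ : ∀ p₁ p₂ p₃ p₄ {b₁₂ b₁₃ b₁₄ b₂₃ b₂₄ b₃₄} →
  qPair p₁ p₂ ≡ b₁₂ → qPair p₁ p₃ ≡ b₁₃ → qPair p₁ p₄ ≡ b₁₄ → qPair p₂ p₃ ≡ b₂₃ → qPair p₂ p₄ ≡ b₂₄ → qPair p₃ p₄ ≡ b₃₄ →
  qInversions (p₁ ∷ p₂ ∷ p₃ ∷ p₄ ∷ []) ≡ bit b₃₄ ℕ.+ bit b₂₄ ℕ.+ bit b₂₃ ℕ.+ bit b₁₄ ℕ.+ bit b₁₃ ℕ.+ bit b₁₂
qInversions₄ p₁ p₂ p₃ p₄ refl refl refl refl refl refl = ring (bit (qPair p₃ p₄)) (bit (qPair p₂ p₄))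
  (bit (qPair p₂ p₃)) (bit (qPair p₁ p₄)) (bit (qPair p₁ p₃)) (bit (qPair p₁ p₂))
  where
  ring : ∀ a b c d e f → 0 ℕ.+ 0 ℕ.+ (0 ℕ.+ a) ℕ.+ (0 ℕ.+ b ℕ.+ c) ℕ.+ (0 ℕ.+ d ℕ.+ e ℕ.+ f) ≡ a ℕ.+ b ℕ.+ c ℕ.+ d ℕ.+ e ℕ.+ f
  ring = ℕ-Solver.solve-∀

-- In a word (x₁ , j , 1) ∷ (h₁ , j , 2) ∷ (x₂ , j , 1) ∷ (h₂ , j , 2) ∷ [], path i enters
-- crossing j at level xᵢ and leaves it at level hᵢ.
module CrossingWeights (a j : ℕ) where

  block : List Var
  block = crossingBlock a j
  A₁ A₂ B₁ B₂ : Var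
  A₁ = (a , j , 1)
  A₂ = (a , j , 2)
  B₁ = (suc a , j , 1)
  B₂ = (suc a , j , 2)

  zCoeff-block : ∀ w {k} → w ↭ block → qInversions w ≡ k → zCoeff block w ≡ tpow (+ k)
  zCoeff-block w w↭ refl = zCoeff-↭ w (crossingBlock-sorted a j) w↭

  a≢2+a : a ≢ suc (suc a)
  a≢2+a = ℕP.<⇒≢ (ℕP.<-trans (ℕP.n<1+n a) (ℕP.n<1+n (suc a)))

  straight-up : zCoeff block (A₁ ∷ A₂ ∷ B₁ ∷ B₂ ∷ []) ≡ tpow (+ 0)
  straight-up = zCoeff-block _ ↭-refl (qInversions₄ A₁ A₂ B₁ B₂
    (qPair-level j 1 j 2 (n≢1+n a)) (qPair-level j 1 j 1 a≢2+a) (qPair-ends a j (suc a) 1≢2)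
    (qPair-ends a j (suc a) (1≢2 ∘ sym)) (qPair-level j 2 j 2 a≢2+a) (qPair-ends (suc a) j (suc a) 1≢2))

  crossed-up : zCoeff block (A₁ ∷ B₂ ∷ B₁ ∷ A₂ ∷ []) ≡ tpow (+ 1)
  crossed-up = zCoeff-block _
    (prep _ (↭-trans (swap _ _ ↭-refl) (↭-trans (prep _ (swap _ _ ↭-refl)) (swap _ _ ↭-refl))))
    (qInversions₄ A₁ B₂ B₁ A₂ (qPair-ends a j (suc a) 1≢2) (qPair-level j 1 j 1 a≢2+a) (qPair-ends a j a 1≢2)
      (qPair-ends (suc a) j (suc a) (1≢2 ∘ sym)) (qPair-below a j 2) (qPair-ends (suc a) j a 1≢2))

  crossed-down : zCoeff block (B₁ ∷ A₂ ∷ A₁ ∷ B₂ ∷ []) ≡ tpow (+ 1)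
  crossed-down = zCoeff-block _
    (↭-trans (swap _ _ ↭-refl) (↭-trans (prep _ (swap _ _ ↭-refl)) (swap _ _ ↭-refl)))
    (qInversions₄ B₁ A₂ A₁ B₂ (qPair-ends (suc a) j a 1≢2) (qPair-below a j 1) (qPair-ends (suc a) j (suc a) 1≢2)
      (qPair-ends a j a (1≢2 ∘ sym)) (qPair-level j 2 j 2 a≢2+a) (qPair-ends a j (suc a) 1≢2))

  straight-down : zCoeff block (B₁ ∷ B₂ ∷ A₁ ∷ A₂ ∷ []) ≡ tpow (+ 2)
  straight-down = zCoeff-block _
    (↭-trans (prep _ (↭-trans (swap _ _ ↭-refl) (prep _ (swap _ _ ↭-refl))))
             (↭-trans (swap _ _ ↭-refl) (prep _ (swap _ _ ↭-refl))))
    (qInversions₄ B₁ B₂ A₁ A₂ (qPair-level j 1 j 2 (n≢1+n (suc a))) (qPair-below a j 1) (qPair-ends (suc a) j a 1≢2)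
      (qPair-ends (suc a) j a (1≢2 ∘ sym)) (qPair-below a j 2) (qPair-level j 1 j 2 (n≢1+n a)))

  -- both paths leaving at the same level h repeat the variable (h , j , 2)
  same-exit : ∀ x₁ x₂ h → zCoeff block ((x₁ , j , 1) ∷ (h , j , 2) ∷ (x₂ , j , 1) ∷ (h , j , 2) ∷ []) ≡ 0L
  same-exit x₁ x₂ h = zCoeff-¬↭ _ λ w↭ → repeated (Unique-resp-↭ (↭-sym w↭) block-unique)
    where
    block-unique : Unique block
    block-unique = AllPairs.map (λ x<y x≡y → <ᵛ-irrefl (subst (_ <ᵛ_) (sym x≡y) x<y)) (crossingBlock-sorted a j)
    repeated : ¬ Unique ((x₁ , j , 1) ∷ (h , j , 2) ∷ (x₂ , j , 1) ∷ (h , j , 2) ∷ [])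
    repeated (_ ∷ (_ ∷ ne ∷ []) ∷ _) = ne refl


pathSum : ℕ → ℕ → List ℕ → Word → Word → Laurent
pathSum n j as u v = ∑ (zCoeff (zGFrom n j as)) (pathWords j as u v)

ascentWeight : ℕ → Word → Laurent
ascentWeight a u = if ascentAt a u then 1L else qL

qPair-sameCrossing : ∀ j x y → qPair x y ≡ true → (crossingOf x ≡ j → crossingOf y ≡ j) × (crossingOf y ≡ j → crossingOf x ≡ j)
qPair-sameCrossing j (h , j₁ , k) (h′ , j₂ , k′) p
  with does-true (j₁ ℕ.≟ j₂) (proj₁ (∧-true (proj₂ (∧-true {does (h ℕ.≟ suc h′)} p))))
... | refl = id , id

+L-four : ∀ {g₁₁ g₁₂ g₂₁ g₂₂ x y} → g₁₁ ≋ 0L → g₁₂ ≋ x → g₂₁ ≋ y → g₂₂ ≋ 0L →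
  (g₁₁ +L (g₁₂ +L 0L)) +L ((g₂₁ +L (g₂₂ +L 0L)) +L 0L) ≋ x +L y
+L-four {x = x} {y} p q r s = ≋-trans
  (+L-cong (+L-cong p (+L-cong q ≋-refl)) (+L-cong (+L-cong r (+L-cong s ≋-refl)) ≋-refl))
  (+L-cong (+L-identityʳ x) (≋-trans (+L-identityʳ _) (+L-identityʳ y)))

module CrossingStep (n j : ℕ) (as : List ℕ) (v : Word) where

  P : Word → Laurent
  P c = pathSum n (suc j) as c v

  term : ℕ → Word → Word → Laurent
  term a u c = zCoeff (crossingBlock a j) (crossingWord j a u c) *L P c

  ∑-terms : ∀ {a u} (d : CrossingLetters a u) → let open CrossingLetters d in
    ∑ (λ h₁ → ∑ (λ h₂ → term a u (u₁ ++ h₁ ∷ u₂ ++ h₂ ∷ u₃)) (a ∷ suc a ∷ [])) (a ∷ suc a ∷ [])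
    ≋ ascentWeight a u *L P u +L tpow (+ 1) *L P (swapAt a u)
  ∑-terms {a} {u} d@(crossingLetters u₁ u₂ u₃ x₁ x₂ split _ _ _ (inj₁ (refl , refl)))
    rewrite CrossingLettersProperties.ascentAt-up d refl =
    +L-four (vanish a) (weigh straight-up (sym split)) (weigh crossed-up (sym swapAt-split)) (vanish (suc a))
    where
    open CrossingLettersProperties d
    open CrossingWeights a j
    c : ℕ → ℕ → Word
    c h₁ h₂ = u₁ ++ h₁ ∷ u₂ ++ h₂ ∷ u₃
    term≡ : ∀ h₁ h₂ → term a u (c h₁ h₂) ≡ zCoeff block (A₁ ∷ (h₁ , j , 2) ∷ B₁ ∷ (h₂ , j , 2) ∷ []) *L P (c h₁ h₂)
    term≡ h₁ h₂ = cong (λ w → zCoeff block w *L P (c h₁ h₂)) (crossingWord-split j h₁ h₂)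
    vanish : ∀ h → term a u (c h h) ≋ 0L
    vanish h = ≡⇒≋ (trans (term≡ h h) (cong (_*L P (c h h)) (same-exit a (suc a) h)))
    weigh : ∀ {h₁ h₂ k w} → zCoeff block (A₁ ∷ (h₁ , j , 2) ∷ B₁ ∷ (h₂ , j , 2) ∷ []) ≡ tpow k → c h₁ h₂ ≡ w →
      term a u (c h₁ h₂) ≋ tpow k *L P w
    weigh {h₁} {h₂} z≡ refl = ≡⇒≋ (trans (term≡ h₁ h₂) (cong (_*L P (c h₁ h₂)) z≡))
  ∑-terms {a} {u} d@(crossingLetters u₁ u₂ u₃ x₁ x₂ split _ _ _ (inj₂ (refl , refl)))
    rewrite CrossingLettersProperties.ascentAt-down d refl =
    ≋-trans (+L-four (vanish a) (weigh crossed-down (sym swapAt-split)) (weigh straight-down (sym split)) (vanish (suc a)))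
            (+L-comm (tpow (+ 1) *L P (swapAt a u)) (qL *L P u))
    where
    open CrossingLettersProperties d
    open CrossingWeights a j
    c : ℕ → ℕ → Word
    c h₁ h₂ = u₁ ++ h₁ ∷ u₂ ++ h₂ ∷ u₃
    term≡ : ∀ h₁ h₂ → term a u (c h₁ h₂) ≡ zCoeff block (B₁ ∷ (h₁ , j , 2) ∷ A₁ ∷ (h₂ , j , 2) ∷ []) *L P (c h₁ h₂)
    term≡ h₁ h₂ = cong (λ w → zCoeff block w *L P (c h₁ h₂)) (crossingWord-split j h₁ h₂)
    vanish : ∀ h → term a u (c h h) ≋ 0L
    vanish h = ≡⇒≋ (trans (term≡ h h) (cong (_*L P (c h h)) (same-exit (suc a) a h)))
    weigh : ∀ {h₁ h₂ k w} → zCoeff block (B₁ ∷ (h₁ , j , 2) ∷ A₁ ∷ (h₂ , j , 2) ∷ []) ≡ tpow k → c h₁ h₂ ≡ w →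
      term a u (c h₁ h₂) ≋ tpow k *L P w
    weigh {h₁} {h₂} z≡ refl = ≡⇒≋ (trans (term≡ h₁ h₂) (cong (_*L P (c h₁ h₂)) z≡))

  pathSum-step : ∀ a u → 1 ≤ a → suc a ≤ n → IsPerm n u → length u ≡ length v →
    pathSum n j (a ∷ as) u v ≋ ascentWeight a u *L P u +L tpow (+ 1) *L P (swapAt a u)
  pathSum-step a u 1≤a 1+a≤n p ∣u∣≡∣v∣ = begin
    pathSum n j (a ∷ as) u v
      ≈⟨ ∑-cong (pathWords j (a ∷ as) u v) (λ w → ≋-trans (zCoeff-split _ w (zGFrom-sorted n j (a ∷ as)))
           (≡⇒≋ (cong₂ (λ z z′ → zCoeff z (atJ w) *L zCoeff z′ (afterJ w))
                       (filter-atCrossing n j a as 1≤a 1+a≤n) (filter-laterCrossings n j a as)))) ⟩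
    ∑ (λ w → F (atJ w) (afterJ w)) (pathWords j (a ∷ as) u v)
      ≈⟨ ∑-pathWords F u v ∣u∣≡∣v∣ ⟩
    ∑ (λ c → ∑ (F (crossingWord j a u c)) (pathWords (suc j) as c v)) (exitLevels a u)
      ≈⟨ ∑-cong (exitLevels a u) (λ c → ≋-sym (*L-∑ (zCoeff (crossingBlock a j) (crossingWord j a u c)) (zCoeff (zGFrom n (suc j) as)) (pathWords (suc j) as c v))) ⟩
    ∑ (term a u) (exitLevels a u)
      ≈⟨ CrossingLettersProperties.∑-exitLevels-split d (term a u) ⟩
    ∑ (λ h₁ → ∑ (λ h₂ → term a u (u₁ ++ h₁ ∷ u₂ ++ h₂ ∷ u₃)) (a ∷ suc a ∷ [])) (a ∷ suc a ∷ [])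
      ≈⟨ ∑-terms d ⟩
    ascentWeight a u *L P u +L tpow (+ 1) *L P (swapAt a u) ∎
    where
    open ≋-Reasoning
    open SplitBy (atCrossing? j) (qPair-sameCrossing j)
    open FirstCrossing j a as
    F : List Var → List Var → Laurent
    F R R′ = zCoeff (crossingBlock a j) R *L zCoeff (zGFrom n (suc j) as) R′
    d : CrossingLetters a u
    d = findCrossingLetters p 1≤a 1+a≤n
    open CrossingLetters d

≡ᵇ-refl : ∀ x → (x ℕ.≡ᵇ x) ≡ true
≡ᵇ-refl x = dec-true (x ℕ.≟ x) refl

≢⇒≡ᵇ-false : ∀ {x y} → x ≢ y → (x ℕ.≡ᵇ y) ≡ false
≢⇒≡ᵇ-false {x} {y} = dec-false (x ℕ.≟ y)

pathSum-[] : ∀ n j u v → length u ≡ length v → pathSum n j [] u v ≋ kronecker u v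
pathSum-[] n j u v ∣u∣≡∣v∣ rewrite zGFrom-[] n j = go u v ∣u∣≡∣v∣
  where
  go : ∀ u v → length u ≡ length v → ∑ (zCoeff []) (pathWords j [] u v) ≋ kronecker u v
  go [] [] _ = ≋-refl
  go (x ∷ u) (y ∷ v) ∣u∣≡∣v∣ with x ℕ.≟ y
  ... | yes refl rewrite ≡ᵇ-refl x = begin
    ∑ (zCoeff []) (map ([] ++_) (pathWords j [] u v) ++ [])
      ≈⟨ ≋-trans (∑-++ (zCoeff []) (map ([] ++_) (pathWords j [] u v)) []) (+L-identityʳ _) ⟩
    ∑ (zCoeff []) (map ([] ++_) (pathWords j [] u v))
      ≈⟨ ≋-trans (∑-map (zCoeff []) ([] ++_) (pathWords j [] u v)) (go u v (ℕP.suc-injective ∣u∣≡∣v∣)) ⟩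
    kronecker u v ∎
    where open ≋-Reasoning
  ... | no x≢y rewrite ≢⇒≡ᵇ-false x≢y = ≋-refl

-- the coefficient [z_G] b_{u₁,v₁} ⋯ b_{uₖ,vₖ}, computed crossing by crossing
pathCoeff : List ℕ → Word → Word → Laurent
pathCoeff [] u v = kronecker u v
pathCoeff (a ∷ as) u v = ascentWeight a u *L pathCoeff as u v +L tpow (+ 1) *L pathCoeff as (swapAt a u) v

ValidLevel : ℕ → ℕ → Set
ValidLevel n a = 1 ≤ a × suc a ≤ n

IsPerm-swapAt : ∀ {n a u} → ValidLevel n a → IsPerm n u → IsPerm n (swapAt a u)
IsPerm-swapAt (1≤a , 1+a≤n) p = ↭-trans (CrossingLettersProperties.swapAt-↭ (findCrossingLetters p 1≤a 1+a≤n)) p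

pathSum≋pathCoeff : ∀ n j as u v → All (ValidLevel n) as → IsPerm n u → length u ≡ length v →
  pathSum n j as u v ≋ pathCoeff as u v
pathSum≋pathCoeff n j [] u v [] p ∣u∣≡∣v∣ = pathSum-[] n j u v ∣u∣≡∣v∣
pathSum≋pathCoeff n j (a ∷ as) u v (valid ∷ valids) p ∣u∣≡∣v∣ =
  ≋-trans (CrossingStep.pathSum-step n j as v a u (proj₁ valid) (proj₂ valid) p ∣u∣≡∣v∣)
    (+L-cong (*L-congʳ (ascentWeight a u) (pathSum≋pathCoeff n (suc j) as u v valids p ∣u∣≡∣v∣))
             (*L-congʳ (tpow (+ 1)) (pathSum≋pathCoeff n (suc j) as (swapAt a u) v valids (IsPerm-swapAt valid p)
               (trans (LP.length-map (swapLetter a) u) ∣u∣≡∣v∣))))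

-- Matching the two sides

negLen : Word → ℤ
negLen u = ℤ.- (+ len u)

immanantSum : (Word → Laurent) → ℕ → List ℕ → Word → Laurent
immanantSum θ n as u = ∑ (λ v → (θ v *L tpow (negLen v)) *L pathCoeff as u v) (perms n)

-- ℓ(w s_a) = ℓ(w) ± 1 turns the weights 1, q^{1/2} (ascent) and q, q^{1/2} (descent)
-- into the factors 1, 1 and q, q of evalProduct.
evalProduct-step : ∀ θ a as {u} (d : CrossingLetters a u) →
  ascentWeight a u *L (tpow (negLen u) *L evalProduct θ as u) +L tpow (+ 1) *L (tpow (negLen (swapAt a u)) *L evalProduct θ as (swapAt a u))
  ≋ tpow (negLen u) *L evalProduct θ (a ∷ as) u
evalProduct-step θ a as {u} d@(crossingLetters _ _ _ _ _ _ _ _ _ (inj₁ (refl , refl)))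
  rewrite CrossingLettersProperties.ascentAt-up d refl = begin
  1L *L (tpow (negLen u) *L X) +L tpow (+ 1) *L (tpow (negLen σu) *L Y)
    ≈⟨ +L-cong (*L-identityˡ (tpow (negLen u) *L X)) (≋-trans (tpow-*L (+ 1) (negLen σu) Y) (*L-congˡ Y (≡⇒≋ (cong tpow exponent)))) ⟩
  tpow (negLen u) *L X +L tpow (negLen u) *L Y
    ≈⟨ ≋-sym (*L-distribˡ (tpow (negLen u)) X Y) ⟩
  tpow (negLen u) *L (X +L Y) ∎
  where
  open ≋-Reasoning
  σu : Word
  σu = swapAt a u
  X Y : Laurent
  X = evalProduct θ as u
  Y = evalProduct θ as σu
  exponent : + 1 ℤ.+ negLen σu ≡ negLen u
  exponent rewrite CrossingLettersProperties.len-swapAt-up d refl = ring (+ len u)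
    where
    ring : ∀ m → + 1 ℤ.+ ℤ.- (+ 1 ℤ.+ m) ≡ ℤ.- m
    ring = ℤ-Solver.solve-∀
evalProduct-step θ a as {u} d@(crossingLetters _ _ _ _ _ _ _ _ _ (inj₂ (refl , refl)))
  rewrite CrossingLettersProperties.ascentAt-down d refl = begin
  qL *L (tpow (negLen u) *L X) +L tpow (+ 1) *L (tpow (negLen σu) *L Y)
    ≈⟨ +L-cong (*L-left-comm qL (tpow (negLen u)) X)
         (≋-trans (tpow-*L (+ 1) (negLen σu) Y) (≋-trans (*L-congˡ Y (≡⇒≋ (cong tpow exponent))) (≋-sym (tpow-*L (negLen u) (+ 2) Y)))) ⟩
  tpow (negLen u) *L (qL *L X) +L tpow (negLen u) *L (qL *L Y)
    ≈⟨ ≋-sym (*L-distribˡ (tpow (negLen u)) (qL *L X) (qL *L Y)) ⟩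
  tpow (negLen u) *L (qL *L X +L qL *L Y) ∎
  where
  open ≋-Reasoning
  σu : Word
  σu = swapAt a u
  X Y : Laurent
  X = evalProduct θ as u
  Y = evalProduct θ as σu
  exponent : + 1 ℤ.+ negLen σu ≡ negLen u ℤ.+ + 2
  exponent rewrite sym (CrossingLettersProperties.len-swapAt-down d refl) = ring (+ len σu)
    where
    ring : ∀ m → + 1 ℤ.+ ℤ.- m ≡ ℤ.- (+ 1 ℤ.+ m) ℤ.+ + 2
    ring = ℤ-Solver.solve-∀

immanantSum≋evalProduct : ∀ θ n as u → All (ValidLevel n) as → IsPerm n u →
  immanantSum θ n as u ≋ tpow (negLen u) *L evalProduct θ as u
immanantSum≋evalProduct θ n [] u [] p =
  ≋-trans (∑-kronecker (λ v → θ v *L tpow (negLen v)) (perms n) (perms-unique n) (perms-complete n p))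
          (*L-comm (θ u) (tpow (negLen u)))
immanantSum≋evalProduct θ n (a ∷ as) u (valid ∷ valids) p = begin
  ∑ (λ v → f v *L (A *L pathCoeff as u v +L t *L pathCoeff as σu v)) (perms n)
    ≈⟨ ∑-cong (perms n) (λ v → ≋-trans (*L-distribˡ (f v) _ _)
         (+L-cong (*L-left-comm (f v) A (pathCoeff as u v)) (*L-left-comm (f v) t (pathCoeff as σu v)))) ⟩
  ∑ (λ v → A *L (f v *L pathCoeff as u v) +L t *L (f v *L pathCoeff as σu v)) (perms n)
    ≈⟨ ∑-+ _ _ (perms n) ⟩
  ∑ (λ v → A *L (f v *L pathCoeff as u v)) (perms n) +L ∑ (λ v → t *L (f v *L pathCoeff as σu v)) (perms n)
    ≈⟨ +L-cong (≋-sym (*L-∑ A _ (perms n))) (≋-sym (*L-∑ t _ (perms n))) ⟩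
  A *L immanantSum θ n as u +L t *L immanantSum θ n as σu
    ≈⟨ +L-cong (*L-congʳ A (immanantSum≋evalProduct θ n as u valids p))
               (*L-congʳ t (immanantSum≋evalProduct θ n as σu valids (IsPerm-swapAt valid p))) ⟩
  A *L (tpow (negLen u) *L evalProduct θ as u) +L t *L (tpow (negLen σu) *L evalProduct θ as σu)
    ≈⟨ evalProduct-step θ a as (findCrossingLetters p (proj₁ valid) (proj₂ valid)) ⟩
  tpow (negLen u) *L evalProduct θ (a ∷ as) u ∎
  where
  open ≋-Reasoning
  f : Word → Laurent
  f v = θ v *L tpow (negLen v)
  σu : Word
  σu = swapAt a u
  A t : Laurent
  A = ascentWeight a u
  t = tpow (+ 1)


unit : List Var → Laurent × List Var
unit w = (1L , w)

pathEntry≡sinkPaths : ∀ as i x → pathEntry as i x ≡ map unit (sinkPaths 1 as i x)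
pathEntry≡sinkPaths as i x = go (paths i 1 as)
  where
  go : ∀ pes → concatMap (λ { (p , e) → if does (e ℕ.≟ x) then (1L , p) ∷ [] else [] }) pes
             ≡ map unit (concatMap (sinkAt x) pes)
  go [] = refl
  go ((p , e) ∷ pes) = trans (cong₂ _++_ unit-sink (go pes))
                             (sym (LP.map-++ (1L ,_) (sinkAt x (p , e)) (concatMap (sinkAt x) pes)))
    where
    unit-sink : (if does (e ℕ.≟ x) then (1L , p) ∷ [] else []) ≡ map unit (sinkAt x (p , e))
    unit-sink with does (e ℕ.≟ x)
    ... | true = refl
    ... | false = refl

*Z-unit : ∀ (ps ws : List (List Var)) →
  map unit ps *Z map unit ws ≡ map unit (concatMap (λ p → map (p ++_) ws) ps)
*Z-unit [] ws = refl
*Z-unit (p ∷ ps) ws = trans (cong₂ _++_ (prefix ws) (*Z-unit ps ws))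
  (sym (LP.map-++ (1L ,_) (map (p ++_) ws) (concatMap (λ p → map (p ++_) ws) ps)))
  where
  prefix : ∀ ws → map (λ { (d , w) → (1L *L d , p ++ w) }) (map unit ws) ≡ map unit (map (p ++_) ws)
  prefix [] = refl
  prefix (w ∷ ws) = cong ((1L , p ++ w) ∷_) (prefix ws)

bProductFrom≡pathWords : ∀ as i v → bProductFrom as i v ≡ map unit (pathWords 1 as (interval i (length v)) v)
bProductFrom≡pathWords as i [] = refl
bProductFrom≡pathWords as i (x ∷ v) =
  trans (cong₂ _*Z_ (pathEntry≡sinkPaths as i x) (bProductFrom≡pathWords as (suc i) v))
        (*Z-unit (sinkPaths 1 as i x) (pathWords 1 as (interval (suc i) (length v)) v))

coeffZG-unit : ∀ z ws → coeffZG z (map unit ws) ≋ ∑ (zCoeff z) ws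
coeffZG-unit z [] = ≋-refl
coeffZG-unit z (w ∷ ws) = +L-cong coeff-w (coeffZG-unit z ws)
  where
  coeff-w : (if does (proj₂ (normal w) ≟Vs z) then 1L *L tpow (proj₁ (normal w)) else 0L) ≋ zCoeff z w
  coeff-w with does (proj₂ (normal w) ≟Vs z)
  ... | true = *L-identityˡ (tpow (proj₁ (normal w)))
  ... | false = ≋-refl

coeffZG-bProduct : ∀ n as v → All (ValidLevel n) as → IsPerm n v →
  coeffZG (zG n as) (bProduct as v) ≋ pathCoeff as (idWord n) v
coeffZG-bProduct n as v valids p = begin
  coeffZG (zGFrom n 1 as) (bProductFrom as 1 v)
    ≈⟨ ≋-trans (≡⇒≋ (cong (coeffZG (zGFrom n 1 as)) (bProductFrom≡pathWords as 1 v))) (coeffZG-unit (zGFrom n 1 as) (pathWords 1 as (interval 1 (length v)) v)) ⟩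
  pathSum n 1 as (interval 1 (length v)) v
    ≡⟨ cong (λ u → pathSum n 1 as u v) (trans (cong (interval 1) (IsPerm-length p)) (sym (idWord≡interval n))) ⟩
  pathSum n 1 as (idWord n) v
    ≈⟨ pathSum≋pathCoeff n 1 as (idWord n) v valids ↭-refl (trans (IsPerm-length {n} ↭-refl) (sym (IsPerm-length p))) ⟩
  pathCoeff as (idWord n) v ∎
  where open ≋-Reasoning

len-idWord : ∀ n → len (idWord n) ≡ 0
len-idWord n rewrite idWord≡interval n = len-interval 1 n
  where
  len-interval : ∀ i k → len (interval i k) ≡ 0
  len-interval i zero = refl
  len-interval i (suc k) = cong₂ ℕ._+_ (none (interval (suc i) k) (All.map proj₁ (interval-bounds (suc i) k))) (len-interval (suc i) k)
    where
    none : ∀ xs → All (i <_) xs → smaller i xs ≡ 0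
    none xs later = cong length (LP.filter-none (ℕ._<? i) (All.map ℕP.<⇒≯ later))
    interval-bounds : ∀ i k → All (λ x → i ≤ x × x < i ℕ.+ k) (interval i k)
    interval-bounds i zero = []
    interval-bounds i (suc k) = (ℕP.≤-refl , subst (i <_) (sym (ℕP.+-suc i k)) (s≤s (ℕP.m≤m+n i k)))
      ∷ All.map (λ {x} (i<x , x<) → ℕP.<⇒≤ i<x , subst (x <_) (sym (ℕP.+-suc i k)) x<) (interval-bounds (suc i) k)

gen-valid : ∀ n (expr : List (Fin (n ∸ 1))) → All (ValidLevel n) (map (gen {n}) expr)
gen-valid n [] = []
gen-valid (suc n) (i ∷ expr) = (s≤s z≤n , s≤s (FP.toℕ<n i)) ∷ gen-valid (suc n) expr

theorem3p7 : (n : ℕ) (θ : Word → Laurent) (expr : List (Fin (n ∸ 1))) →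
    applyLinear θ (heckeProduct n (map (gen {n}) expr)) ≈ sigmaB n (map (gen {n}) expr) (Imm n θ)
theorem3p7 n θ expr = un (begin
  applyLinear θ (heckeProduct n as)
    ≈⟨ applyLinear-foldl θ as ((1L , idWord n) ∷ []) ⟩
  1L *L evalProduct θ as (idWord n) +L 0L
    ≈⟨ +L-identityʳ _ ⟩
  1L *L evalProduct θ as (idWord n)
    ≡⟨ cong (λ ℓ → tpow (ℤ.- (+ ℓ)) *L evalProduct θ as (idWord n)) (sym (len-idWord n)) ⟩
  tpow (negLen (idWord n)) *L evalProduct θ as (idWord n)
    ≈⟨ ≋-sym (immanantSum≋evalProduct θ n as (idWord n) valids ↭-refl) ⟩
  ∑ (λ v → (θ v *L tpow (negLen v)) *L pathCoeff as (idWord n) v) (perms n)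
    ≈⟨ ∑-congᴬ (All.tabulate λ {v} v∈ → *L-congʳ (θ v *L tpow (negLen v)) (≋-sym (coeffZG-bProduct n as v valids (perms-sound n v∈)))) ⟩
  ∑ (λ v → (θ v *L tpow (negLen v)) *L coeffZG (zG n as) (bProduct as v)) (perms n)
    ≈⟨ ≋-sym (∑-map _ _ (perms n)) ⟩
  sigmaB n as (Imm n θ) ∎)
  where
  open ≋-Reasoning
  as : List ℕ
  as = map (gen {n}) expr
  valids : All (ValidLevel n) as
  valids = gen-valid n expr
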